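{- For every finite graph $G$, $$\mathrm{wcol}^*_2(G)\le 3\nabla_0(G)^2+1+\min\big(\nabla_0(G)\nabla_1(G),\ \nabla_0(G)^2\,\widetilde{\nabla}_{1/2}(G)\big).$$
   Context: Graphs are finite and simple; the average degree of a graph $H$ is $2|E(H)|/|V(H)|$. For a linear order $\pi$ on $V(G)$, a vertex $u$ is weakly $2$-reachable from $v$ if there is a path $P$ of length at most $2$ between $u$ and $v$ with $u\le_\pi x$ for all vertices $x$ of $P$. $\mathrm{wcol}^*_2(G)$ is the minimum $k$ such that for some linear order $\pi$ on $V(G)$ there is a coloring of $V(G)$ with $k$ colors such that for each vertex $v$, every vertex $u\ne v$ weakly 2-reachable from $v$ gets a color different from that of $v$. For an integer $r\ge 0$, $\nabla_r(G)$ is the maximum average degree of a graph $H$ obtainable from $G$ by contracting disjoint balls of radius at most $r$, i.e., such that there are pairwise disjoint sets $V_x\subseteq V(G)$ ($x\in V(H)$), each inducing a connected subgraph of $G$ of radius at most $r$, with an edge of $G$ between $V_x$ and $V_y$ for every edge $xy$ of $H$ (so $\nabla_0(G)$ is the maximum average degree of a subgraph of $G$). $\widetilde{\nabla}_{1/2}(G)$ is the maximum average degree of a graph $H$ such that $G$ contains as a subgraph a subdivision of $H$ in which each edge of $H$ is subdivided at most once (replaced by a path with at most 2 edges). -}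

module Defs where

open import Data.Nat as ℕ using (ℕ; zero; suc; _<ᵇ_)
open import Data.Fin using (Fin; toℕ)
open import Data.Bool using (Bool; true; false; _∧_; if_then_else_)
open import Data.List using (List; map; allFin)
open import Data.Nat.ListAction using (sum)
open import Data.Maybe using (Maybe; just; nothing)
open import Data.Product using (Σ; ∃; _×_; _,_)
open import Data.Sum using (_⊎_)
open import Data.Integer using (+_)
open import Data.Rational using (ℚ; _/_; _≤_)
open import Relation.Binary.PropositionalEquality using (_≡_; _≢_)
open import Function.Definitions using (Injective)

record Graph (n : ℕ) : Set where
  field
    adj    : Fin n → Fin n → Bool
    sym    : ∀ u v → adj u v ≡ adj v u
    irrefl : ∀ u → adj u u ≡ false
open Graph public

_⊢_~_ : ∀ {n} → Graph n → Fin n → Fin n → Set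
G ⊢ u ~ v = adj G u v ≡ true

numEdges : ∀ {n} → Graph n → ℕ
numEdges {n} H =
  sum (map (λ i → sum (map (λ j → if (toℕ i <ᵇ toℕ j) ∧ adj H i j then 1 else 0)
                             (allFin n)))
           (allFin n))

avgDeg : ∀ {m} → Graph (suc m) → ℚ
avgDeg {m} H = + (2 ℕ.* numEdges H) / suc m

-- Walks of length at most k staying inside a vertex set S.
data WalkIn {n} (G : Graph n) (S : Fin n → Set) : ℕ → Fin n → Fin n → Set where
  nil  : ∀ {k u} → S u → WalkIn G S k u u
  cons : ∀ {k u w v} → S u → G ⊢ u ~ w → WalkIn G S k w v → WalkIn G S (suc k) u v

-- A model of H in G by pairwise disjoint branch sets V_x (x ∈ V(H)) of radius ≤ r.
-- Disjointness is built in: each vertex of G lies in at most one branch set,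
-- namely β v (nothing = in no branch set).
record DepthMinor {n m} (G : Graph n) (r : ℕ) (H : Graph m) : Set where
  field
    β      : Fin n → Maybe (Fin m)
    centre : Fin m → Fin n
    centre-in : ∀ x → β (centre x) ≡ just x
    radius : ∀ x v → β v ≡ just x →
             WalkIn G (λ w → β w ≡ just x) r (centre x) v
    edges  : ∀ x y → H ⊢ x ~ y →
             Σ (Fin n) λ u → Σ (Fin n) λ v →
               β u ≡ just x × β v ≡ just y × G ⊢ u ~ v

-- H is a ≤1-subdivision contained in G: branch vertices φ x; each edge xy
-- (x < y) of H is a G-edge φx φy (mid = nothing) or a path φx – s – φy
-- through a subdivision vertex s = mid x y that is not a branch vertex and
-- is used by no other edge.
record HalfSubdivision {n m} (G : Graph n) (H : Graph m) : Set where
  field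
    φ     : Fin m → Fin n
    φ-inj : Injective _≡_ _≡_ φ
    mid   : Fin m → Fin m → Maybe (Fin n)
    direct : ∀ x y → toℕ x ℕ.< toℕ y → H ⊢ x ~ y → mid x y ≡ nothing →
             G ⊢ φ x ~ φ y
    subdiv : ∀ x y s → toℕ x ℕ.< toℕ y → H ⊢ x ~ y → mid x y ≡ just s →
             (G ⊢ φ x ~ s) × (G ⊢ s ~ φ y) × (∀ z → φ z ≢ s)
    subdiv-unique : ∀ x y x' y' s →
             toℕ x ℕ.< toℕ y → H ⊢ x ~ y → mid x y ≡ just s →
             toℕ x' ℕ.< toℕ y' → H ⊢ x' ~ y' → mid x' y' ≡ just s →
             (x ≡ x') × (y ≡ y')

IsMaxAvgDeg : (P : ∀ {m} → Graph (suc m) → Set) → ℚ → Set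
IsMaxAvgDeg P d =
  (Σ ℕ λ m → Σ (Graph (suc m)) λ H → P H × avgDeg H ≡ d) ×
  (∀ m (H : Graph (suc m)) → P H → avgDeg H ≤ d)

IsNabla : ∀ {n} → Graph n → ℕ → ℚ → Set
IsNabla G r d = IsMaxAvgDeg (λ H → DepthMinor G r H) d

IsNablaTildeHalf : ∀ {n} → Graph n → ℚ → Set
IsNablaTildeHalf G d = IsMaxAvgDeg (λ H → HalfSubdivision G H) d

LinOrder : ℕ → Set
LinOrder n = Σ (Fin n → Fin n) λ pos → Injective _≡_ _≡_ pos

_≤[_]_ : ∀ {n} → Fin n → LinOrder n → Fin n → Set
u ≤[ pos , _ ] x = toℕ (pos u) ℕ.≤ toℕ (pos x)

WReach2 : ∀ {n} → Graph n → LinOrder n → Fin n → Fin n → Set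
WReach2 G π u v =
  u ≡ v ⊎
  (G ⊢ u ~ v × u ≤[ π ] v) ⊎
  (Σ _ λ w → G ⊢ u ~ w × G ⊢ w ~ v × u ≤[ π ] w × u ≤[ π ] v)

Wcol2Colourable : ∀ {n} → Graph n → ℕ → Set
Wcol2Colourable {n} G k =
  Σ (LinOrder n) λ π → Σ (Fin n → Fin k) λ c →
    ∀ u v → u ≢ v → WReach2 G π u v → c u ≢ c v

IsWcol2* : ∀ {n} → Graph n → ℕ → Set
IsWcol2* G k = Wcol2Colourable G k × (∀ k' → Wcol2Colourable G k' → k ℕ.≤ k')

-- Order V(G) by degeneracy, so that every vertex has at most D = ⌊∇₀⌋ earlier neighbours.  If u is
-- weakly 2-reachable from v, then u and v are adjacent, joined by a 2-path increasing in the order, or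
-- have a common later neighbour w; call such u, v in conflict.  It suffices to bound the average degree
-- of the conflict graph on every S ⊆ V(G): it is then degenerate, and a greedy colouring needs one more
-- colour than that bound.  Increasing 2-paths and common later neighbours in S give at most 3D²|S|
-- ordered pairs.  For w ∉ S, record the ranks i, j of u, v among the earlier neighbours of w.  For fixed
-- i, merging each u with the w it is the i-th earlier neighbour of is a depth-1 minor on S, so the D layers
-- contribute at most D∇₁|S|; for fixed (i, j) each w subdivides at most one edge, so the D² layers are
-- ≤1-subdivisions contributing at most D²∇̃½|S|.

module Submission where

open import Data.Nat as ℕ using (ℕ; suc)
import Defs

module Counting where

  open import Data.Nat
  open import Data.Nat.Properties
  open import Data.Fin using (Fin; zero; suc)
  open import Data.Fin.Properties using () renaming (_≟_ to _≟ᶠ_)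
  open import Data.Bool using (Bool; true; false; _∧_; _∨_; not; if_then_else_)
  open import Data.Sum using (_⊎_; inj₁; inj₂)
  open import Data.Maybe using (Maybe; just; nothing)
  open import Data.Product using (∃; _,_)
  open import Data.Empty using (⊥-elim)
  open import Relation.Nullary using (yes; no)
  open import Relation.Nullary.Decidable using (isYes)
  open import Data.Bool.Properties using (T-≡)
  open import Function.Bundles using (Equivalence)
  open import Relation.Binary.PropositionalEquality
  open import Algebra.Properties.Semiring.Sum +-*-semiring public
    using (sum; sum-cong-≗; ∑-distrib-+; ∑-comm; *-distribˡ-sum; sum-replicate-zero)

  ⟦_⟧ : Bool → ℕ
  ⟦ true ⟧ = 1
  ⟦ false ⟧ = 0

  ⟦⟧≤1 : ∀ b → ⟦ b ⟧ ≤ 1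
  ⟦⟧≤1 true = ≤-refl
  ⟦⟧≤1 false = z≤n

  ⟦∧⟧ : ∀ a b → ⟦ a ∧ b ⟧ ≡ ⟦ a ⟧ * ⟦ b ⟧
  ⟦∧⟧ true b = sym (+-identityʳ ⟦ b ⟧)
  ⟦∧⟧ false b = refl

  ⟦∧⟧-flip : ∀ a b → ⟦ a ∧ b ⟧ ≡ ⟦ b ⟧ * ⟦ a ⟧
  ⟦∧⟧-flip a b = trans (⟦∧⟧ a b) (*-comm ⟦ a ⟧ ⟦ b ⟧)

  if≡⟦⟧* : ∀ b x → (if b then x else 0) ≡ ⟦ b ⟧ * x
  if≡⟦⟧* true x = sym (+-identityʳ x)
  if≡⟦⟧* false x = refl

  if≡*⟦⟧ : ∀ b x → (if b then x else 0) ≡ x * ⟦ b ⟧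
  if≡*⟦⟧ b x = trans (if≡⟦⟧* b x) (*-comm ⟦ b ⟧ x)

  ⟦⟧-if : ∀ b → (if b then 1 else 0) ≡ ⟦ b ⟧
  ⟦⟧-if true = refl
  ⟦⟧-if false = refl

  sum-mono-≤ : ∀ {n} {f g : Fin n → ℕ} → (∀ i → f i ≤ g i) → sum f ≤ sum g
  sum-mono-≤ {zero} h = z≤n
  sum-mono-≤ {suc n} h = +-mono-≤ (h zero) (sum-mono-≤ (λ i → h (suc i)))

  sum-zero : ∀ {n} (f : Fin n → ℕ) → (∀ i → f i ≡ 0) → sum f ≡ 0
  sum-zero {n} f h = trans (sum-cong-≗ h) (sum-replicate-zero n)

  sum-const : ∀ n c → sum {n} (λ _ → c) ≡ n * c
  sum-const zero c = refl
  sum-const (suc n) c = cong (c +_) (sum-const n c)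

  sum-*ˡ : ∀ {n} c (f : Fin n → ℕ) → sum (λ i → c * f i) ≡ c * sum f
  sum-*ˡ c f = sym (*-distribˡ-sum c f)

  term≤sum : ∀ {n} (f : Fin n → ℕ) i → f i ≤ sum f
  term≤sum f zero = m≤m+n _ _
  term≤sum f (suc i) = ≤-trans (term≤sum (λ j → f (suc j)) i) (m≤n+m _ _)

  sum-<⇒term-< : ∀ {n} (f g : Fin n → ℕ) → sum f < sum g → ∃ λ i → f i < g i
  sum-<⇒term-< {suc n} f g lt with f zero <? g zero
  ... | yes f₀<g₀ = zero , f₀<g₀
  ... | no f₀≮g₀ =
    let (i , fᵢ<gᵢ) = sum-<⇒term-< (λ i → f (suc i)) (λ i → g (suc i))
                        (+-cancelˡ-< (g zero) _ _ (≤-<-trans (+-monoˡ-≤ _ (≮⇒≥ f₀≮g₀)) lt))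
    in suc i , fᵢ<gᵢ

  _==_ : ∀ {n} → Fin n → Fin n → Bool
  i == j = isYes (i ≟ᶠ j)

  ==-refl : ∀ {n} (i : Fin n) → (i == i) ≡ true
  ==-refl i with i ≟ᶠ i
  ... | yes _ = refl
  ... | no i≢i = ⊥-elim (i≢i refl)

  ==⇒≡ : ∀ {n} {i j : Fin n} → (i == j) ≡ true → i ≡ j
  ==⇒≡ {i = i} {j} h with i ≟ᶠ j
  ... | yes i≡j = i≡j

  ==-false⇒≢ : ∀ {n} {i j : Fin n} → (i == j) ≡ false → i ≢ j
  ==-false⇒≢ {i = i} {j} h with i ≟ᶠ j
  ... | no i≢j = i≢j

  ≢⇒==-false : ∀ {n} {i j : Fin n} → i ≢ j → (i == j) ≡ false
  ≢⇒==-false {i = i} {j} i≢j with i ≟ᶠ j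
  ... | yes i≡j = ⊥-elim (i≢j i≡j)
  ... | no _ = refl

  ==-sym : ∀ {n} (i j : Fin n) → (i == j) ≡ (j == i)
  ==-sym i j with i ≟ᶠ j | j ≟ᶠ i
  ... | yes _ | yes _ = refl
  ... | no _ | no _ = refl
  ... | yes i≡j | no j≢i = ⊥-elim (j≢i (sym i≡j))
  ... | no i≢j | yes j≡i = ⊥-elim (i≢j (sym j≡i))

  sum-at : ∀ {n} (u : Fin n) (f : Fin n → ℕ) → sum (λ i → if i == u then f i else 0) ≡ f u
  sum-at {suc n} zero f =
    trans (cong (f zero +_) (sum-zero (λ i → if suc i == zero then f (suc i) else 0) (λ _ → refl)))
          (+-identityʳ _)
  sum-at {suc n} (suc u) f = trans (sum-cong-≗ shift) (sum-at u (λ i → f (suc i)))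
    where
    shift : ∀ i → (if suc i == suc u then f (suc i) else 0) ≡ (if i == u then f (suc i) else 0)
    shift i with i ≟ᶠ u
    ... | yes refl = refl
    ... | no _ = refl

  find : ∀ {n} → (Fin n → Bool) → Maybe (Fin n)
  find {zero} P = nothing
  find {suc n} P with P zero
  ... | true = just zero
  ... | false with find (λ i → P (suc i))
  ...   | just i = just (suc i)
  ...   | nothing = nothing

  find-just : ∀ {n} (P : Fin n → Bool) {w} → find P ≡ just w → P w ≡ true
  find-just {suc n} P h with P zero in P₀
  find-just {suc n} P refl | true = P₀
  ... | false with find (λ i → P (suc i)) in found
  find-just {suc n} P refl | false | just i = find-just (λ i → P (suc i)) found

  find-nothing : ∀ {n} (P : Fin n → Bool) → find P ≡ nothing → ∀ w → P w ≡ false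
  find-nothing {suc n} P h w with P zero in P₀
  find-nothing {suc n} P () w | true
  ... | false with find (λ i → P (suc i)) in found
  find-nothing {suc n} P () w | false | just i
  find-nothing {suc n} P refl zero | false | nothing = P₀
  find-nothing {suc n} P refl (suc w) | false | nothing = find-nothing (λ i → P (suc i)) found w

  find-cong : ∀ {n} (P Q : Fin n → Bool) → (∀ w → P w ≡ Q w) → find P ≡ find Q
  find-cong {zero} P Q h = refl
  find-cong {suc n} P Q h rewrite h zero with Q zero
  ... | true = refl
  ... | false rewrite find-cong (λ i → P (suc i)) (λ i → Q (suc i)) (λ i → h (suc i)) = refl

  ∃ᵇ : ∀ {n} → (Fin n → Bool) → Bool
  ∃ᵇ P with find P
  ... | just _ = true
  ... | nothing = false

  ∃ᵇ-intro : ∀ {n} (P : Fin n → Bool) w → P w ≡ true → ∃ᵇ P ≡ true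
  ∃ᵇ-intro P w Pw with find P in found
  ... | just _ = refl
  ... | nothing with trans (sym Pw) (find-nothing P found w)
  ... | ()

  ∃ᵇ-elim : ∀ {n} (P : Fin n → Bool) → ∃ᵇ P ≡ true → ∃ λ w → P w ≡ true
  ∃ᵇ-elim P h with find P in found
  ... | just w = w , find-just P found

  ∃ᵇ-false : ∀ {n} (P : Fin n → Bool) → ∃ᵇ P ≡ false → ∀ w → P w ≡ false
  ∃ᵇ-false P h w with find P in found
  ∃ᵇ-false P () w | just _
  ... | nothing = find-nothing P found w

  ∃ᵇ-cong : ∀ {n} (P Q : Fin n → Bool) → (∀ w → P w ≡ Q w) → ∃ᵇ P ≡ ∃ᵇ Q
  ∃ᵇ-cong P Q h with find P | find Q | find-cong P Q h
  ... | just _ | just _ | _ = refl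
  ... | nothing | nothing | _ = refl

  ⟦∃ᵇ⟧≤sum : ∀ {n} (P : Fin n → Bool) → ⟦ ∃ᵇ P ⟧ ≤ sum (λ w → ⟦ P w ⟧)
  ⟦∃ᵇ⟧≤sum P with ∃ᵇ P in h
  ... | false = z≤n
  ... | true with ∃ᵇ-elim P h
  ... | (w , Pw) = subst (λ b → ⟦ b ⟧ ≤ sum (λ w → ⟦ P w ⟧)) Pw (term≤sum (λ w → ⟦ P w ⟧) w)

  <⇒<ᵇ≡true : ∀ {m n} → m < n → (m <ᵇ n) ≡ true
  <⇒<ᵇ≡true m<n = Equivalence.to T-≡ (<⇒<ᵇ m<n)

  <ᵇ≡true⇒< : ∀ {m n} → (m <ᵇ n) ≡ true → m < n
  <ᵇ≡true⇒< m<n = <ᵇ⇒< _ _ (Equivalence.from T-≡ m<n)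

  ≤⇒≮ᵇ : ∀ {m n} → m ≤ n → (n <ᵇ m) ≡ false
  ≤⇒≮ᵇ {m} {n} m≤n with n <ᵇ m in n<m
  ... | false = refl
  ... | true = ⊥-elim (<⇒≱ (<ᵇ≡true⇒< n<m) m≤n)

  ∨-introˡ : ∀ {a} b → a ≡ true → (a ∨ b) ≡ true
  ∨-introˡ b refl = refl

  ∨-introʳ : ∀ a {b} → b ≡ true → (a ∨ b) ≡ true
  ∨-introʳ true refl = refl
  ∨-introʳ false refl = refl

  ∨-elim : ∀ a {b} → (a ∨ b) ≡ true → (a ≡ true) ⊎ (b ≡ true)
  ∨-elim true _ = inj₁ refl
  ∨-elim false h = inj₂ h

  ∧-intro : ∀ {a b} → a ≡ true → b ≡ true → (a ∧ b) ≡ true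
  ∧-intro refl refl = refl

  ∧-elimˡ : ∀ a {b} → (a ∧ b) ≡ true → a ≡ true
  ∧-elimˡ true _ = refl

  ∧-elimʳ : ∀ a {b} → (a ∧ b) ≡ true → b ≡ true
  ∧-elimʳ true h = h

  not-intro : ∀ {a} → a ≡ false → not a ≡ true
  not-intro refl = refl

  not-elim : ∀ {a} → not a ≡ true → a ≡ false
  not-elim {false} _ = refl

  true≢false : true ≢ false
  true≢false ()

module Subgraphs where

  open import Data.Nat hiding (∣_-_∣)
  open import Data.Nat.Properties
  open import Data.Fin using (Fin; zero; suc; toℕ)
  import Data.Fin.Properties as Fin
  open import Data.Bool using (Bool; true; false; _∧_; not; if_then_else_)
  import Data.Bool.Properties as Bool
  open import Data.List using (map; allFin; tabulate)
  import Data.List.Properties as List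
  import Data.Nat.ListAction as List
  open import Data.Product using (∃; _×_; _,_)
  open import Data.Empty using (⊥-elim)
  open import Relation.Nullary using (yes; no)
  open import Relation.Binary.Definitions using (tri<; tri≈; tri>)
  open import Relation.Binary.PropositionalEquality
  open import Data.Maybe using (Maybe; just; nothing)
  open import Function using (_∘_; id)
  open import Axiom.UniquenessOfIdentityProofs using (module Decidable⇒UIP)
  open import Defs hiding (sym)
  open Counting

  Subset : ℕ → Set
  Subset n = Fin n → Bool

  Rel : ℕ → Set
  Rel n = Fin n → Fin n → Bool

  ∣_∣ : ∀ {n} → Subset n → ℕ
  ∣ S ∣ = sum (λ v → ⟦ S v ⟧)

  _-_ : ∀ {n} → Subset n → Fin n → Subset n
  (S - v) u = S u ∧ not (u == v)

  -‿≢ : ∀ {n} (S : Subset n) {v u} → u ≢ v → (S - v) u ≡ S u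
  -‿≢ S {v} {u} u≢v rewrite ≢⇒==-false u≢v = Bool.∧-identityʳ (S u)

  ∣-∣ : ∀ {n} (S : Subset n) v → S v ≡ true → ∣ S ∣ ≡ ∣ S - v ∣ + 1
  ∣-∣ S v Sv = trans (sum-cong-≗ split)
    (trans (∑-distrib-+ (λ u → ⟦ (S - v) u ⟧) (λ u → if u == v then 1 else 0))
           (cong (∣ S - v ∣ +_) (sum-at v (λ _ → 1))))
    where
    split : ∀ u → ⟦ S u ⟧ ≡ ⟦ (S - v) u ⟧ + (if u == v then 1 else 0)
    split u with u == v in u=v
    ... | true rewrite ==⇒≡ u=v | Sv = refl
    ... | false with S u
    ... | true = refl
    ... | false = refl

  ∣-∣-suc : ∀ {n} (S : Subset n) {s} v → S v ≡ true → ∣ S ∣ ≡ suc s → ∣ S - v ∣ ≡ s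
  ∣-∣-suc S {s} v Sv eq = +-cancelʳ-≡ 1 _ _ (trans (sym (∣-∣ S v Sv)) (trans eq (+-comm 1 s)))

  ∣∣≡0⇒empty : ∀ {n} (S : Subset n) → ∣ S ∣ ≡ 0 → ∀ v → S v ≡ false
  ∣∣≡0⇒empty S eq v with S v in Sv
  ... | false = refl
  ... | true with ≤-trans (subst (λ b → 1 ≤ ⟦ b ⟧) (sym Sv) ≤-refl)
                          (≤-trans (term≤sum (λ v → ⟦ S v ⟧) v) (≤-reflexive eq))
  ... | ()

  ∣∣≡suc⇒nonempty : ∀ {n} (S : Subset n) {m} → ∣ S ∣ ≡ suc m → ∃ λ w → S w ≡ true
  ∣∣≡suc⇒nonempty S eq with ∃ᵇ S in h
  ... | true = ∃ᵇ-elim S h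
  ... | false with trans (sym eq) (sum-zero (λ v → ⟦ S v ⟧) (λ v → cong ⟦_⟧ (∃ᵇ-false S h v)))
  ... | ()

  ∣full∣ : ∀ {n} → ∣ (λ (_ : Fin n) → true) ∣ ≡ n
  ∣full∣ {n} = trans (sum-const n 1) (*-identityʳ n)

  argmin : ∀ {n} (S : Subset n) (f : Fin n → ℕ) → (∃ λ w → S w ≡ true) →
           ∃ λ v → S v ≡ true × (∀ u → S u ≡ true → f v ≤ f u)
  argmin {suc n} S f (w , Sw) with ∃ᵇ (S ∘ suc) in h
  argmin {suc n} S f (zero , S₀) | false =
    zero , S₀ , λ { zero _ → ≤-refl ; (suc u) Su → ⊥-elim (true≢false (trans (sym Su) (∃ᵇ-false _ h u))) }
  argmin {suc n} S f (suc w , Sw) | false = ⊥-elim (true≢false (trans (sym Sw) (∃ᵇ-false _ h w)))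
  ... | true with argmin (S ∘ suc) (f ∘ suc) (∃ᵇ-elim _ h)
  ...   | (v , Sv , min) with S zero in S₀
  ...     | false = suc v , Sv , λ { zero S₀′ → ⊥-elim (true≢false (trans (sym S₀′) S₀)) ; (suc u) Su → min u Su }
  ...     | true with f zero ≤? f (suc v)
  ...       | yes f₀≤ = zero , S₀ , λ { zero _ → ≤-refl ; (suc u) Su → ≤-trans f₀≤ (min u Su) }
  ...       | no f₀≰ = suc v , Sv , λ { zero _ → <⇒≤ (≰⇒> f₀≰) ; (suc u) Su → min u Su }

  degIn : ∀ {n} → Rel n → Subset n → Fin n → ℕ
  degIn K S v = sum (λ u → if S u then ⟦ K v u ⟧ else 0)

  edgeSum : ∀ {n} → Rel n → Subset n → ℕ
  edgeSum K S = sum (λ v → if S v then degIn K S v else 0)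

  minDegree : ∀ {n} (K : Rel n) (S : Subset n) {m} → ∣ S ∣ ≡ suc m →
              ∃ λ v → S v ≡ true × degIn K S v * ∣ S ∣ ≤ edgeSum K S
  minDegree K S ∣S∣≡1+m with argmin S (degIn K S) (∣∣≡suc⇒nonempty S ∣S∣≡1+m)
  ... | (v , Sv , min) = v , Sv , ≤-trans (≤-reflexive spread) (sum-mono-≤ pointwise)
    where
    spread : degIn K S v * ∣ S ∣ ≡ sum (λ u → if S u then degIn K S v else 0)
    spread = trans (sym (sum-*ˡ (degIn K S v) (λ u → ⟦ S u ⟧))) (sum-cong-≗ λ u → sym (if≡*⟦⟧ (S u) (degIn K S v)))
    pointwise : ∀ u → (if S u then degIn K S v else 0) ≤ (if S u then degIn K S u else 0)
    pointwise u with S u in Su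
    ... | true = min u Su
    ... | false = z≤n

  record Enumeration {n} (S : Subset n) (k : ℕ) : Set where
    field
      elem       : Fin k → Fin n
      elem-∈     : ∀ a → S (elem a) ≡ true
      index      : ∀ v → S v ≡ true → Fin k
      elem-index : ∀ v p → elem (index v p) ≡ v
      index-elem : ∀ a p → index (elem a) p ≡ a
      sum-elem   : ∀ (g : Fin n → ℕ) → sum (λ a → g (elem a)) ≡ sum (λ v → if S v then g v else 0)

    elem-injective : ∀ {a b} → elem a ≡ elem b → a ≡ b
    elem-injective {a} {b} eq =
      trans (sym (index-elem a (elem-∈ a))) (trans (index-cong eq (elem-∈ a) (elem-∈ b)) (index-elem b (elem-∈ b)))
      where
      index-cong : ∀ {x y} → x ≡ y → (p : S x ≡ true) (q : S y ≡ true) → index x p ≡ index y q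
      index-cong refl p q = cong (index _) (Decidable⇒UIP.≡-irrelevant Bool._≟_ p q)

    sum-elem² : ∀ (K : Rel n) → sum (λ a → sum (λ b → ⟦ K (elem a) (elem b) ⟧)) ≡ edgeSum K S
    sum-elem² K = trans (sum-cong-≗ (λ a → sum-elem (λ u → ⟦ K (elem a) u ⟧))) (sum-elem (degIn K S))

  enumerate : ∀ {n} (S : Subset n) → Enumeration S ∣ S ∣
  enumerate {zero} S = record
    { elem = λ () ; elem-∈ = λ () ; index = λ () ; elem-index = λ () ; index-elem = λ () ; sum-elem = λ g → refl }
  enumerate {suc n} S = prepend (S zero) refl
    where
    module Tail = Enumeration (enumerate (S ∘ suc))
    prepend : (b : Bool) → S zero ≡ b → Enumeration S (⟦ b ⟧ + ∣ S ∘ suc ∣)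
    prepend true S₀ = record
      { elem = elem ; elem-∈ = elem-∈ ; index = index ; elem-index = elem-index
      ; index-elem = index-elem ; sum-elem = sum-elem }
      where
      elem : Fin (suc ∣ S ∘ suc ∣) → Fin (suc n)
      elem zero = zero
      elem (suc a) = suc (Tail.elem a)
      elem-∈ : ∀ a → S (elem a) ≡ true
      elem-∈ zero = S₀
      elem-∈ (suc a) = Tail.elem-∈ a
      index : ∀ v → S v ≡ true → Fin (suc ∣ S ∘ suc ∣)
      index zero _ = zero
      index (suc v) p = suc (Tail.index v p)
      elem-index : ∀ v p → elem (index v p) ≡ v
      elem-index zero _ = refl
      elem-index (suc v) p = cong suc (Tail.elem-index v p)
      index-elem : ∀ a p → index (elem a) p ≡ a
      index-elem zero _ = refl
      index-elem (suc a) p = cong suc (Tail.index-elem a p)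
      sum-elem : ∀ g → sum (g ∘ elem) ≡ sum (λ v → if S v then g v else 0)
      sum-elem g rewrite S₀ = cong (g zero +_) (Tail.sum-elem (g ∘ suc))
    prepend false S₀ = record
      { elem = suc ∘ Tail.elem ; elem-∈ = Tail.elem-∈ ; index = index ; elem-index = elem-index
      ; index-elem = Tail.index-elem ; sum-elem = sum-elem }
      where
      index : ∀ v → S v ≡ true → Fin ∣ S ∘ suc ∣
      index zero p = ⊥-elim (true≢false (trans (sym p) S₀))
      index (suc v) p = Tail.index v p
      elem-index : ∀ v p → suc (Tail.elem (index v p)) ≡ v
      elem-index zero p = ⊥-elim (true≢false (trans (sym p) S₀))
      elem-index (suc v) p = cong suc (Tail.elem-index v p)
      sum-elem : ∀ g → sum (g ∘ suc ∘ Tail.elem) ≡ sum (λ v → if S v then g v else 0)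
      sum-elem g rewrite S₀ = Tail.sum-elem (g ∘ suc)

  enumerateOfSize : ∀ {n} (S : Subset n) {k} → ∣ S ∣ ≡ k → Enumeration S k
  enumerateOfSize S ∣S∣≡k = subst (Enumeration S) ∣S∣≡k (enumerate S)

  module Index {n} {S : Subset n} {m} (E : Enumeration S (suc m)) where
    open Enumeration E

    indexOf : Fin n → Fin (suc m)
    indexOf v with find (λ a → elem a == v)
    ... | just a = a
    ... | nothing = zero

    elem-indexOf : ∀ {v} → S v ≡ true → elem (indexOf v) ≡ v
    elem-indexOf {v} Sv with find (λ a → elem a == v) in found
    ... | just a = ==⇒≡ (find-just (λ a → elem a == v) found)
    ... | nothing = ⊥-elim (true≢false (trans (sym (==-refl v))
                      (trans (cong (_== v) (sym (elem-index v Sv))) (find-nothing (λ a → elem a == v) found (index v Sv)))))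

    indexOf-elem : ∀ a → indexOf (elem a) ≡ a
    indexOf-elem a = elem-injective (elem-indexOf (elem-∈ a))

  sum-allFin : ∀ {n} (f : Fin n → ℕ) → List.sum (map f (allFin n)) ≡ sum f
  sum-allFin f = trans (cong List.sum (List.map-tabulate id f)) (go f)
    where
    go : ∀ {n} (h : Fin n → ℕ) → List.sum (tabulate h) ≡ sum h
    go {zero} h = refl
    go {suc n} h = cong (h zero +_) (go (h ∘ suc))

  _<ᶠ_ : ∀ {n} → Fin n → Fin n → Bool
  i <ᶠ j = toℕ i <ᵇ toℕ j

  numEdges≡sum : ∀ {n} (H : Graph n) → numEdges H ≡ sum (λ i → sum (λ j → ⟦ i <ᶠ j ∧ adj H i j ⟧))
  numEdges≡sum {n} H =
    trans (sum-allFin (λ i → List.sum (map (λ j → if (i <ᶠ j) ∧ adj H i j then 1 else 0) (allFin n))))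
          (sum-cong-≗ (λ i → trans (sum-allFin (λ j → if (i <ᶠ j) ∧ adj H i j then 1 else 0)) (sum-cong-≗ (λ j → ⟦⟧-if ((i <ᶠ j) ∧ adj H i j)))))

  ⟦adj⟧-split : ∀ {n} (H : Graph n) i j → ⟦ adj H i j ⟧ ≡ ⟦ i <ᶠ j ∧ adj H i j ⟧ + ⟦ j <ᶠ i ∧ adj H j i ⟧
  ⟦adj⟧-split H i j with <-cmp (toℕ i) (toℕ j)
  ... | tri< i<j _ _ rewrite <⇒<ᵇ≡true i<j | ≤⇒≮ᵇ (<⇒≤ i<j) = sym (+-identityʳ _)
  ... | tri≈ _ i≡j _ rewrite Fin.toℕ-injective i≡j | irrefl H j | Bool.∧-zeroʳ (j <ᶠ j) = refl
  ... | tri> _ _ j<i rewrite <⇒<ᵇ≡true j<i | ≤⇒≮ᵇ (<⇒≤ j<i) | Graph.sym H j i = refl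

  handshake : ∀ {n} (H : Graph n) → 2 * numEdges H ≡ sum (λ i → sum (λ j → ⟦ adj H i j ⟧))
  handshake H = sym (begin
      sum (λ i → sum (λ j → ⟦ adj H i j ⟧))
    ≡⟨ sum-cong-≗ (λ i → trans (sum-cong-≗ (⟦adj⟧-split H i)) (∑-distrib-+ (A i) (λ j → A j i))) ⟩
      sum (λ i → sum (A i) + sum (λ j → A j i))
    ≡⟨ ∑-distrib-+ (λ i → sum (A i)) (λ i → sum (λ j → A j i)) ⟩
      E + sum (λ i → sum (λ j → A j i))
    ≡⟨ cong (E +_) (sym (∑-comm A)) ⟩
      E + E
    ≡⟨ cong (E +_) (sym (+-identityʳ E)) ⟩
      2 * E
    ≡⟨ cong (2 *_) (sym (numEdges≡sum H)) ⟩
      2 * numEdges H ∎)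
    where
    open ≡-Reasoning
    A = λ i j → ⟦ i <ᶠ j ∧ adj H i j ⟧
    E = sum (λ i → sum (A i))

  module Induced {n} {S : Subset n} {m} (E : Enumeration S (suc m))
                 (K : Rel n) (K-sym : ∀ u v → K u v ≡ K v u) (K-irrefl : ∀ u → K u u ≡ false) where
    open Enumeration E

    graph : Graph (suc m)
    graph = record { adj = λ a b → K (elem a) (elem b) ; sym = λ a b → K-sym (elem a) (elem b)
                   ; irrefl = λ a → K-irrefl (elem a) }

    2*numEdges : 2 * numEdges graph ≡ edgeSum K S
    2*numEdges = trans (handshake graph) (sum-elem² K)

  induced-depth0 : ∀ {n} (G : Graph n) {S : Subset n} {m} (E : Enumeration S (suc m)) →
                   DepthMinor G 0 (Induced.graph E (adj G) (Graph.sym G) (irrefl G))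
  induced-depth0 G {S} E = record
    { β = β ; centre = elem ; centre-in = β-elem ; radius = radius
    ; edges = λ x y x~y → elem x , elem y , β-elem x , β-elem y , x~y }
    where
    open Enumeration E
    open Index E
    β : Fin _ → Maybe (Fin _)
    β v = if S v then just (indexOf v) else nothing
    β-elem : ∀ a → β (elem a) ≡ just a
    β-elem a rewrite elem-∈ a = cong just (indexOf-elem a)
    radius : ∀ x v → β v ≡ just x → WalkIn G (λ w → β w ≡ just x) 0 (elem x) v
    radius x v h with S v in Sv
    radius .(indexOf v) v refl | true rewrite elem-indexOf Sv = nil (cong (λ b → if b then just (indexOf v) else nothing) Sv)

  pairSum : ∀ {n} → Subset n → (Fin n → Fin n → ℕ) → ℕ
  pairSum S f = sum (λ v → sum (λ u → ⟦ S v ⟧ * (⟦ S u ⟧ * f v u)))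

  edgeSum≡pairSum : ∀ {n} (K : Rel n) S → edgeSum K S ≡ pairSum S (λ v u → ⟦ K v u ⟧)
  edgeSum≡pairSum K S = sum-cong-≗ λ v →
    trans (if≡⟦⟧* (S v) (degIn K S v))
          (trans (cong (⟦ S v ⟧ *_) (sum-cong-≗ (λ u → if≡⟦⟧* (S u) ⟦ K v u ⟧)))
                 (sym (sum-*ˡ ⟦ S v ⟧ (λ u → ⟦ S u ⟧ * ⟦ K v u ⟧))))

  pairSum-mono-≤ : ∀ {n} {f g : Fin n → Fin n → ℕ} S → (∀ v u → S v ≡ true → S u ≡ true → f v u ≤ g v u) →
                   pairSum S f ≤ pairSum S g
  pairSum-mono-≤ {f = f} {g} S f≤g = sum-mono-≤ (λ v → sum-mono-≤ (λ u → pointwise v u))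
    where
    pointwise : ∀ v u → ⟦ S v ⟧ * (⟦ S u ⟧ * f v u) ≤ ⟦ S v ⟧ * (⟦ S u ⟧ * g v u)
    pointwise v u with S v in Sv | S u in Su
    ... | true | true = *-monoʳ-≤ 1 (*-monoʳ-≤ 1 (f≤g v u Sv Su))
    ... | true | false = ≤-refl
    ... | false | _ = z≤n

  pairSum-+ : ∀ {n} (f g : Fin n → Fin n → ℕ) S → pairSum S (λ v u → f v u + g v u) ≡ pairSum S f + pairSum S g
  pairSum-+ f g S = trans (sum-cong-≗ (λ v → trans (sum-cong-≗ (distrib v)) (∑-distrib-+ (F v) (G v))))
                          (∑-distrib-+ (λ v → sum (F v)) (λ v → sum (G v)))
    where
    F G : Fin _ → Fin _ → ℕ
    F v u = ⟦ S v ⟧ * (⟦ S u ⟧ * f v u)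
    G v u = ⟦ S v ⟧ * (⟦ S u ⟧ * g v u)
    distrib : ∀ v u → ⟦ S v ⟧ * (⟦ S u ⟧ * (f v u + g v u)) ≡ F v u + G v u
    distrib v u rewrite *-distribˡ-+ ⟦ S u ⟧ (f v u) (g v u) = *-distribˡ-+ ⟦ S v ⟧ _ _

  pairSum-flip : ∀ {n} (f : Fin n → Fin n → ℕ) S → pairSum S (λ v u → f u v) ≡ pairSum S f
  pairSum-flip f S = trans (∑-comm (λ v u → ⟦ S v ⟧ * (⟦ S u ⟧ * f u v))) (sum-cong-≗ (λ v → sum-cong-≗ (λ u → swap v u)))
    where
    swap : ∀ v u → ⟦ S u ⟧ * (⟦ S v ⟧ * f v u) ≡ ⟦ S v ⟧ * (⟦ S u ⟧ * f v u)
    swap v u = trans (sym (*-assoc ⟦ S u ⟧ _ _)) (trans (cong (_* f v u) (*-comm ⟦ S u ⟧ ⟦ S v ⟧)) (*-assoc ⟦ S v ⟧ _ _))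

  pairSum-sum : ∀ {n D} (h : Fin D → Fin n → Fin n → ℕ) S →
                pairSum S (λ v u → sum (λ i → h i v u)) ≡ sum (λ i → pairSum S (h i))
  pairSum-sum h S = trans (sum-cong-≗ (λ v → trans (sum-cong-≗ (λ u → pull v u)) (∑-comm (λ u i → ⟦ S v ⟧ * (⟦ S u ⟧ * h i v u)))))
    (∑-comm (λ v i → sum (λ u → ⟦ S v ⟧ * (⟦ S u ⟧ * h i v u))))
    where
    pull : ∀ v u → ⟦ S v ⟧ * (⟦ S u ⟧ * sum (λ i → h i v u)) ≡ sum (λ i → ⟦ S v ⟧ * (⟦ S u ⟧ * h i v u))
    pull v u = trans (cong (⟦ S v ⟧ *_) (sym (sum-*ˡ ⟦ S u ⟧ (λ i → h i v u)))) (sym (sum-*ˡ ⟦ S v ⟧ (λ i → ⟦ S u ⟧ * h i v u)))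

  pairSum≤outer : ∀ {n} (f : Fin n → Fin n → ℕ) S → pairSum S f ≤ sum (λ v → ⟦ S v ⟧ * sum (λ u → f v u))
  pairSum≤outer f S = sum-mono-≤ (λ v → ≤-trans (sum-mono-≤ (λ u → drop v u)) (≤-reflexive (sum-*ˡ ⟦ S v ⟧ (λ u → f v u))))
    where
    drop : ∀ v u → ⟦ S v ⟧ * (⟦ S u ⟧ * f v u) ≤ ⟦ S v ⟧ * f v u
    drop v u = *-monoʳ-≤ ⟦ S v ⟧ (≤-trans (*-monoˡ-≤ (f v u) (⟦⟧≤1 (S u))) (≤-reflexive (*-identityˡ (f v u))))

  pairSum≤sum : ∀ {n} (f : Fin n → Fin n → ℕ) S → pairSum S f ≤ sum (λ v → sum (λ u → f v u))
  pairSum≤sum f S = ≤-trans (pairSum≤outer f S)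
    (sum-mono-≤ (λ v → ≤-trans (*-monoˡ-≤ (sum (λ u → f v u)) (⟦⟧≤1 (S v))) (≤-reflexive (*-identityˡ _))))

  sum-⟦⟧*≡∣∣* : ∀ {n} (S : Subset n) c → sum (λ v → ⟦ S v ⟧ * c) ≡ ∣ S ∣ * c
  sum-⟦⟧*≡∣∣* S c = trans (sum-cong-≗ (λ v → *-comm ⟦ S v ⟧ c)) (trans (sum-*ˡ c (λ v → ⟦ S v ⟧)) (*-comm c ∣ S ∣))

module Degeneracy where

  open import Data.Nat hiding (∣_-_∣)
  open import Data.Nat.Properties
  open import Data.Fin using (Fin; zero; toℕ; fromℕ<)
  import Data.Fin.Properties as Fin
  open import Data.Bool using (Bool; true; false; _∧_; if_then_else_)
  import Data.Bool.Properties as Bool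
  open import Data.Product using (Σ-syntax; ∃; _×_; _,_)
  open import Data.Empty using (⊥-elim)
  open import Relation.Binary.PropositionalEquality
  open import Defs hiding (sym)
  open Counting
  open Subgraphs

  Degenerate : ∀ {n} → Rel n → ℕ → Set
  Degenerate {n} K t = ∀ (S : Subset n) m → ∣ S ∣ ≡ suc m → ∃ λ v → S v ≡ true × degIn K S v ≤ t

  precedes : ∀ {n} → LinOrder n → Fin n → Fin n → Bool
  precedes (pos , _) u v = toℕ (pos u) <ᵇ toℕ (pos v)

  module _ {n} (K : Rel n) (t : ℕ) (degenerate : Degenerate K t) where

    private
      FewEarlierNeighbours : Subset n → (Fin n → ℕ) → Set
      FewEarlierNeighbours S r = ∀ v → S v ≡ true → sum (λ u → ⟦ S u ∧ (K v u ∧ (r u <ᵇ r v)) ⟧) ≤ t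

      -- A minimum-degree vertex of S takes the last rank; the rest of S is ranked recursively.
      ranking : ∀ s (S : Subset n) → ∣ S ∣ ≡ s → Σ[ r ∈ (Fin n → ℕ) ]
                  (∀ v → S v ≡ true → r v < s) ×
                  (∀ u v → S u ≡ true → S v ≡ true → r u ≡ r v → u ≡ v) ×
                  FewEarlierNeighbours S r
      ranking zero S ∣S∣≡0 = (λ _ → 0) , (λ v Sv → ⊥-elim (empty Sv)) , (λ u v Su _ _ → ⊥-elim (empty Su)) ,
                              (λ v Sv → ⊥-elim (empty Sv))
        where
        empty : ∀ {v} → S v ≡ true → _
        empty {v} Sv = true≢false (trans (sym Sv) (∣∣≡0⇒empty S ∣S∣≡0 v))
      ranking (suc s) S ∣S∣≡1+s with degenerate S s ∣S∣≡1+s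
      ... | (v₀ , Sv₀ , deg≤t) with ranking s (S - v₀) (∣-∣-suc S v₀ Sv₀ ∣S∣≡1+s)
      ... | (r′ , r′<s , r′-inj , r′-few) = r , r<1+s , r-inj , r-few
        where
        r : Fin n → ℕ
        r u = if u == v₀ then s else r′ u
        r′<s′ : ∀ {v} → v ≢ v₀ → S v ≡ true → r′ v < s
        r′<s′ {v} v≢v₀ Sv = r′<s v (trans (-‿≢ S v≢v₀) Sv)
        r<1+s : ∀ v → S v ≡ true → r v < suc s
        r<1+s v Sv with v == v₀ in v=v₀
        ... | true = n<1+n s
        ... | false = m<n⇒m<1+n (r′<s′ (==-false⇒≢ v=v₀) Sv)
        r-inj : ∀ u v → S u ≡ true → S v ≡ true → r u ≡ r v → u ≡ v
        r-inj u v Su Sv eq with u == v₀ in u=v₀ | v == v₀ in v=v₀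
        ... | true | true = trans (==⇒≡ u=v₀) (sym (==⇒≡ v=v₀))
        ... | true | false = ⊥-elim (<-irrefl (sym eq) (r′<s′ (==-false⇒≢ v=v₀) Sv))
        ... | false | true = ⊥-elim (<-irrefl eq (r′<s′ (==-false⇒≢ u=v₀) Su))
        ... | false | false =
          r′-inj u v (trans (-‿≢ S (==-false⇒≢ u=v₀)) Su) (trans (-‿≢ S (==-false⇒≢ v=v₀)) Sv) eq
        r-few : FewEarlierNeighbours S r
        r-few v Sv with v == v₀ in v=v₀
        ... | true rewrite ==⇒≡ v=v₀ = ≤-trans (sum-mono-≤ ≤degIn) deg≤t
          where
          ≤degIn : ∀ u → ⟦ S u ∧ (K v₀ u ∧ (r u <ᵇ s)) ⟧ ≤ (if S u then ⟦ K v₀ u ⟧ else 0)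
          ≤degIn u with S u | K v₀ u
          ... | true | true = ⟦⟧≤1 _
          ... | true | false = z≤n
          ... | false | _ = z≤n
        ... | false = ≤-trans (sum-mono-≤ ≤r′) (r′-few v S′v)
          where
          S′v = trans (-‿≢ S (==-false⇒≢ v=v₀)) Sv
          s≮r′v : (s <ᵇ r′ v) ≡ false
          s≮r′v = ≤⇒≮ᵇ (<⇒≤ (r′<s v S′v))
          ≤r′ : ∀ u → ⟦ S u ∧ (K v u ∧ (r u <ᵇ r′ v)) ⟧ ≤ ⟦ (S - v₀) u ∧ (K v u ∧ (r′ u <ᵇ r′ v)) ⟧
          ≤r′ u with u == v₀
          ... | true rewrite s≮r′v | Bool.∧-zeroʳ (K v u) | Bool.∧-zeroʳ (S u) = z≤n
          ... | false rewrite Bool.∧-identityʳ (S u) = ≤-refl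

    degeneracyOrder : Σ[ π ∈ LinOrder n ] ∀ v → sum (λ u → ⟦ K v u ∧ precedes π u v ⟧) ≤ t
    degeneracyOrder with ranking n (λ _ → true) ∣full∣
    ... | (r , r<n , r-inj , r-few) = (pos , pos-inj) , λ v → ≤-trans (≤-reflexive (sum-cong-≗ (toℕ-pos v))) (r-few v refl)
      where
      pos : Fin n → Fin n
      pos v = fromℕ< (r<n v refl)
      toℕ-pos : ∀ v u → ⟦ K v u ∧ (toℕ (pos u) <ᵇ toℕ (pos v)) ⟧ ≡ ⟦ K v u ∧ (r u <ᵇ r v) ⟧
      toℕ-pos v u rewrite Fin.toℕ-fromℕ< (r<n u refl) | Fin.toℕ-fromℕ< (r<n v refl) = refl
      pos-inj : ∀ {u v} → pos u ≡ pos v → u ≡ v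
      pos-inj {u} {v} eq = r-inj u v refl refl
        (trans (sym (Fin.toℕ-fromℕ< (r<n u refl))) (trans (cong toℕ eq) (Fin.toℕ-fromℕ< (r<n v refl))))

  unusedColour : ∀ {n t} (c : Fin n → Fin (suc t)) (P : Subset n) → ∣ P ∣ ≤ t →
                 ∃ λ γ → ∀ u → P u ≡ true → c u ≢ γ
  unusedColour {n} {t} c P ∣P∣≤t with sum-<⇒term-< uses (λ _ → 1) fewer
    where
    uses : Fin (suc t) → ℕ
    uses γ = sum (λ u → ⟦ P u ∧ (c u == γ) ⟧)
    uses-of : ∀ u → sum (λ γ → ⟦ P u ∧ (c u == γ) ⟧) ≡ ⟦ P u ⟧
    uses-of u with P u
    ... | false = sum-replicate-zero (suc t)
    ... | true = trans (sum-cong-≗ (λ γ → trans (cong ⟦_⟧ (==-sym (c u) γ)) (sym (⟦⟧-if (γ == c u)))))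
                       (sum-at (c u) (λ _ → 1))
    fewer : sum uses < sum {suc t} (λ _ → 1)
    fewer = ≤-<-trans (≤-reflexive (trans (∑-comm (λ γ u → ⟦ P u ∧ (c u == γ) ⟧)) (sum-cong-≗ uses-of)))
              (≤-<-trans ∣P∣≤t (≤-reflexive (sym (trans (sum-const (suc t) 1) (*-identityʳ (suc t))))))
  ... | (γ , unused) = γ , λ u Pu cu≡γ →
    <-irrefl refl (<-≤-trans unused (≤-trans (counted u Pu cu≡γ) (term≤sum _ u)))
    where
    counted : ∀ u → P u ≡ true → c u ≡ γ → 1 ≤ ⟦ P u ∧ (c u == γ) ⟧
    counted u Pu cu≡γ rewrite Pu | cu≡γ | ==-refl γ = ≤-refl

  module _ {n} (K : Rel n) (K-sym : ∀ u v → K u v ≡ K v u) (t : ℕ) (degenerate : Degenerate K t) where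

    private
      ProperOn : Subset n → (Fin n → Fin (suc t)) → Set
      ProperOn S c = ∀ u v → S u ≡ true → S v ≡ true → u ≢ v → K u v ≡ true → c u ≢ c v

      greedy : ∀ s (S : Subset n) → ∣ S ∣ ≡ s → Σ[ c ∈ (Fin n → Fin (suc t)) ] ProperOn S c
      greedy zero S ∣S∣≡0 = (λ _ → zero) , λ u v Su _ _ _ _ → true≢false (trans (sym Su) (∣∣≡0⇒empty S ∣S∣≡0 u))
      greedy (suc s) S ∣S∣≡1+s with degenerate S s ∣S∣≡1+s
      ... | (v₀ , Sv₀ , deg≤t) with greedy s (S - v₀) (∣-∣-suc S v₀ Sv₀ ∣S∣≡1+s)
      ... | (c′ , c′-proper) with unusedColour c′ (λ u → (S - v₀) u ∧ K v₀ u) (≤-trans (sum-mono-≤ ≤degIn) deg≤t)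
        where
        ≤degIn : ∀ u → ⟦ (S - v₀) u ∧ K v₀ u ⟧ ≤ (if S u then ⟦ K v₀ u ⟧ else 0)
        ≤degIn u with S u
        ... | false = z≤n
        ... | true with u == v₀
        ... | true = z≤n
        ... | false = ≤-refl
      ... | (γ , γ-unused) = c , c-proper
        where
        c : Fin n → Fin (suc t)
        c u = if u == v₀ then γ else c′ u
        neighbour : ∀ u → u ≢ v₀ → S u ≡ true → K v₀ u ≡ true → ((S - v₀) u ∧ K v₀ u) ≡ true
        neighbour u u≢v₀ Su K₀u rewrite -‿≢ S u≢v₀ | Su | K₀u = refl
        c-proper : ProperOn S c
        c-proper u v Su Sv u≢v Kuv with u == v₀ in u=v₀ | v == v₀ in v=v₀
        ... | true | true = λ _ → u≢v (trans (==⇒≡ u=v₀) (sym (==⇒≡ v=v₀)))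
        ... | true | false rewrite ==⇒≡ u=v₀ =
          λ γ≡c′v → γ-unused v (neighbour v (==-false⇒≢ v=v₀) Sv Kuv) (sym γ≡c′v)
        ... | false | true rewrite ==⇒≡ v=v₀ =
          γ-unused u (neighbour u (==-false⇒≢ u=v₀) Su (trans (K-sym v₀ u) Kuv))
        ... | false | false =
          c′-proper u v (trans (-‿≢ S (==-false⇒≢ u=v₀)) Su) (trans (-‿≢ S (==-false⇒≢ v=v₀)) Sv) u≢v Kuv

    greedyColouring : Σ[ c ∈ (Fin n → Fin (suc t)) ] (∀ u v → u ≢ v → K u v ≡ true → c u ≢ c v)
    greedyColouring with greedy n (λ _ → true) ∣full∣
    ... | (c , c-proper) = c , λ u v → c-proper u v refl refl

module RationalBounds where

  open import Data.Nat as ℕ using (ℕ; zero; suc; z≤n; s≤s)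
  import Data.Nat.Properties as ℕ
  open import Data.Nat.DivMod using (_/_; m/n*n≤m; m≡m%n+[m/n]*n; m%n<n)
  open import Data.Nat.Coprimality using (Coprime)
  open import Data.Integer as ℤ using (+_; -[1+_])
  import Data.Integer.Properties as ℤ
  open import Data.Rational hiding (_/_)
  import Data.Rational as ℚ
  open import Data.Rational.Properties
  import Data.Rational.Unnormalised as ℚᵘ
  import Data.Rational.Unnormalised.Properties as ℚᵘ
  open import Data.Fin as Fin using (Fin)
  open import Data.Sum using (inj₁; inj₂)
  open import Data.Empty using (⊥; ⊥-elim)
  open import Relation.Binary.PropositionalEquality
  open import Relation.Nullary using (yes; no)
  open Counting using (sum)

  fromℕ : ℕ → ℚ
  fromℕ a = + a ℚ./ 1

  private
    fromℕᵘ : ℕ → ℚᵘ.ℚᵘ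
    fromℕᵘ a = ℚᵘ.mkℚᵘ (+ a) 0

    toℚᵘ-fromℕ : ∀ a → toℚᵘ (fromℕ a) ℚᵘ.≃ fromℕᵘ a
    toℚᵘ-fromℕ a = toℚᵘ-fromℚᵘ (fromℕᵘ a)

    fromℕ-≤⇒ᵘ : ∀ {a} {T} → fromℕ a ≤ T → fromℕᵘ a ℚᵘ.≤ toℚᵘ T
    fromℕ-≤⇒ᵘ {a} le = ℚᵘ.≤-respˡ-≃ (toℚᵘ-fromℕ a) (toℚᵘ-mono-≤ le)

    ᵘ⇒fromℕ-≤ : ∀ {a} {T} → fromℕᵘ a ℚᵘ.≤ toℚᵘ T → fromℕ a ≤ T
    ᵘ⇒fromℕ-≤ {a} le = toℚᵘ-cancel-≤ (ℚᵘ.≤-respˡ-≃ (ℚᵘ.≃-sym (toℚᵘ-fromℕ a)) le)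

    transport₂ : ∀ (_∙ℕ_ : ℕ → ℕ → ℕ) (_∙_ : ℚ → ℚ → ℚ) (_∙ᵘ_ : ℚᵘ.ℚᵘ → ℚᵘ.ℚᵘ → ℚᵘ.ℚᵘ) →
                 (∀ p q → toℚᵘ (p ∙ q) ℚᵘ.≃ (toℚᵘ p ∙ᵘ toℚᵘ q)) →
                 (∀ {p p′ q q′} → p ℚᵘ.≃ p′ → q ℚᵘ.≃ q′ → (p ∙ᵘ q) ℚᵘ.≃ (p′ ∙ᵘ q′)) →
                 (∀ a b → fromℕᵘ (a ∙ℕ b) ℚᵘ.≃ (fromℕᵘ a ∙ᵘ fromℕᵘ b)) →
                 ∀ a b → fromℕ (a ∙ℕ b) ≡ fromℕ a ∙ fromℕ b
    transport₂ _ _ _ homo cong-op base a b = toℚᵘ-injective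
      (ℚᵘ.≃-trans (toℚᵘ-fromℕ _) (ℚᵘ.≃-trans (base a b)
        (ℚᵘ.≃-sym (ℚᵘ.≃-trans (homo (fromℕ a) (fromℕ b)) (cong-op (toℚᵘ-fromℕ a) (toℚᵘ-fromℕ b))))))

  fromℕ-+ : ∀ a b → fromℕ (a ℕ.+ b) ≡ fromℕ a + fromℕ b
  fromℕ-+ = transport₂ ℕ._+_ _+_ ℚᵘ._+_ toℚᵘ-homo-+ ℚᵘ.+-cong λ a b → ℚᵘ.*≡* (begin
      + (a ℕ.+ b) ℤ.* + 1               ≡⟨ ℤ.*-identityʳ _ ⟩
      + a ℤ.+ + b                       ≡⟨ cong₂ ℤ._+_ (sym (ℤ.*-identityʳ (+ a))) (sym (ℤ.*-identityʳ (+ b))) ⟩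
      + a ℤ.* + 1 ℤ.+ + b ℤ.* + 1       ≡⟨ sym (ℤ.*-identityʳ _) ⟩
      (+ a ℤ.* + 1 ℤ.+ + b ℤ.* + 1) ℤ.* + 1 ∎)
    where open ≡-Reasoning

  fromℕ-* : ∀ a b → fromℕ (a ℕ.* b) ≡ fromℕ a * fromℕ b
  fromℕ-* = transport₂ ℕ._*_ _*_ ℚᵘ._*_ toℚᵘ-homo-* ℚᵘ.*-cong λ a b →
    ℚᵘ.*≡* (trans (ℤ.*-identityʳ _) (trans (ℤ.pos-* a b) (sym (ℤ.*-identityʳ _))))

  fromℕ-mono-≤ : ∀ {a b} → a ℕ.≤ b → fromℕ a ≤ fromℕ b
  fromℕ-mono-≤ {a} {b} a≤b = ᵘ⇒fromℕ-≤ {a} {fromℕ b} (ℚᵘ.≤-respʳ-≃ (ℚᵘ.≃-sym (toℚᵘ-fromℕ b))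
    (ℚᵘ.*≤* (subst₂ ℤ._≤_ (sym (ℤ.*-identityʳ _)) (sym (ℤ.*-identityʳ _)) (ℤ.+≤+ a≤b))))

  fromℕ-nonNeg : ∀ a → 0ℚ ≤ fromℕ a
  fromℕ-nonNeg a = fromℕ-mono-≤ {0} {a} z≤n

  *-mono-≤-nonNeg : ∀ {a b c d} → 0ℚ ≤ a → 0ℚ ≤ c → a ≤ b → c ≤ d → a * c ≤ b * d
  *-mono-≤-nonNeg {a} {b} {c} {d} 0≤a 0≤c a≤b c≤d =
    ≤-trans (*-monoʳ-≤-nonNeg c {{nonNegative 0≤c}} a≤b) (*-monoˡ-≤-nonNeg b {{nonNegative (≤-trans 0≤a a≤b)}} c≤d)

  ≤+*⇒≤[+]* : ∀ {e L} c s X → e ℕ.≤ L ℕ.+ c ℕ.* suc s → fromℕ L ≤ X * fromℕ (suc s) →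
              fromℕ e ≤ (X + fromℕ c) * fromℕ (suc s)
  ≤+*⇒≤[+]* {e} {L} c s X e≤ L≤ = begin
      fromℕ e                                     ≤⟨ fromℕ-mono-≤ e≤ ⟩
      fromℕ (L ℕ.+ c ℕ.* suc s)                   ≡⟨ fromℕ-+ L (c ℕ.* suc s) ⟩
      fromℕ L + fromℕ (c ℕ.* suc s)               ≡⟨ cong (λ z → fromℕ L + z) (fromℕ-* c (suc s)) ⟩
      fromℕ L + fromℕ c * fromℕ (suc s)           ≤⟨ +-monoˡ-≤ (fromℕ c * fromℕ (suc s)) L≤ ⟩
      X * fromℕ (suc s) + fromℕ c * fromℕ (suc s) ≡⟨ sym (*-distribʳ-+ (fromℕ (suc s)) X (fromℕ c)) ⟩
      (X + fromℕ c) * fromℕ (suc s)               ∎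
    where open ≤-Reasoning

  fromℕ[c*D*D]≤c*d*d : ∀ c D {d} → fromℕ D ≤ d → fromℕ (c ℕ.* (D ℕ.* D)) ≤ fromℕ c * d * d
  fromℕ[c*D*D]≤c*d*d c D {d} D≤d = begin
      fromℕ (c ℕ.* (D ℕ.* D))         ≡⟨ trans (fromℕ-* c _) (cong (fromℕ c *_) (fromℕ-* D D)) ⟩
      fromℕ c * (fromℕ D * fromℕ D)   ≤⟨ *-monoˡ-≤-nonNeg (fromℕ c) {{nonNegative (fromℕ-nonNeg c)}}
                                           (*-mono-≤-nonNeg (fromℕ-nonNeg D) (fromℕ-nonNeg D) D≤d D≤d) ⟩
      fromℕ c * (d * d)               ≡⟨ sym (*-assoc (fromℕ c) d d) ⟩
      fromℕ c * d * d                 ∎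
    where open ≤-Reasoning

  1+[a+b]≤[b′+1]+a′ : ∀ {a a′ b b′} → a ≤ a′ → b ≤ b′ → 1ℚ + (a + b) ≤ (b′ + 1ℚ) + a′
  1+[a+b]≤[b′+1]+a′ {a} {a′} {b} {b′} a≤a′ b≤b′ = begin
      1ℚ + (a + b)   ≡⟨ cong (λ z → 1ℚ + z) (+-comm a b) ⟩
      1ℚ + (b + a)   ≡⟨ sym (+-assoc 1ℚ b a) ⟩
      (1ℚ + b) + a   ≡⟨ cong (_+ a) (+-comm 1ℚ b) ⟩
      (b + 1ℚ) + a   ≤⟨ +-mono-≤ (+-monoˡ-≤ 1ℚ b≤b′) a≤a′ ⟩
      (b′ + 1ℚ) + a′ ∎
    where open ≤-Reasoning

  +-nonNeg : ∀ {a b} → 0ℚ ≤ a → 0ℚ ≤ b → 0ℚ ≤ a + b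
  +-nonNeg 0≤a 0≤b = +-mono-≤ 0≤a 0≤b

  *-nonNeg : ∀ {a b} → 0ℚ ≤ a → 0ℚ ≤ b → 0ℚ ≤ a * b
  *-nonNeg {a} {b} 0≤a 0≤b = *-mono-≤-nonNeg {0ℚ} {a} {0ℚ} {b} ≤-refl ≤-refl 0≤a 0≤b

  fromℕ[D*[D*x]]≤d*d*x : ∀ D {d x} → 0ℚ ≤ x → fromℕ D ≤ d → fromℕ D * (fromℕ D * x) ≤ d * d * x
  fromℕ[D*[D*x]]≤d*d*x D {d} {x} 0≤x D≤d = begin
      fromℕ D * (fromℕ D * x)   ≤⟨ *-mono-≤-nonNeg (fromℕ-nonNeg D) (*-nonNeg (fromℕ-nonNeg D) 0≤x) D≤d
                                     (*-monoʳ-≤-nonNeg x {{nonNegative 0≤x}} D≤d) ⟩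
      d * (d * x)               ≡⟨ sym (*-assoc d d x) ⟩
      d * d * x                 ∎
    where open ≤-Reasoning

  ≤+⊓ : ∀ {x a b c} → x ≤ a + b → x ≤ a + c → x ≤ a + (b ⊓ c)
  ≤+⊓ {x} {a} {b} {c} x≤a+b x≤a+c with ≤-total b c
  ... | inj₁ b≤c = subst (λ z → x ≤ a + z) (sym (p≤q⇒p⊓q≡p b≤c)) x≤a+b
  ... | inj₂ c≤b = subst (λ z → x ≤ a + z) (sym (p≥q⇒p⊓q≡q c≤b)) x≤a+c

  ⌊_⌋ℕ : ℚ → ℕ
  ⌊ mkℚ (+ p) q _ ⌋ℕ = p / suc q
  ⌊ mkℚ -[1+ _ ] _ _ ⌋ℕ = 0

  private
    fromℕ≰negative : ∀ {x p q} .{c : Coprime (suc p) (suc q)} → fromℕ x ≤ mkℚ -[1+ p ] q c → ⊥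
    fromℕ≰negative {x} {p} {q} le with fromℕ-≤⇒ᵘ {x} le
    ... | ℚᵘ.*≤* h with subst₂ ℤ._≤_ (sym (ℤ.pos-* x (suc q))) (ℤ.*-identityʳ -[1+ p ]) h
    ... | ()

  fromℕ⌊⌋ℕ≤ : ∀ T → 0ℚ ≤ T → fromℕ ⌊ T ⌋ℕ ≤ T
  fromℕ⌊⌋ℕ≤ T@(mkℚ (+ p) q _) _ = ᵘ⇒fromℕ-≤ {p / suc q} {T}
    (ℚᵘ.*≤* (subst₂ ℤ._≤_ (ℤ.pos-* (p / suc q) (suc q)) (sym (ℤ.*-identityʳ _)) (ℤ.+≤+ (m/n*n≤m p (suc q)))))
  fromℕ⌊⌋ℕ≤ (mkℚ -[1+ p ] q c) 0≤T = ⊥-elim (fromℕ≰negative {0} 0≤T)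

  ≤⌊⌋ℕ : ∀ {x} T → fromℕ x ≤ T → x ℕ.≤ ⌊ T ⌋ℕ
  ≤⌊⌋ℕ {x} T@(mkℚ (+ p) q _) le with fromℕ-≤⇒ᵘ {x} {T} le
  ... | ℚᵘ.*≤* h = x≤p/q (subst (x ℕ.* suc q ℕ.≤_) (ℕ.*-identityʳ p)
                    (ℤ.drop‿+≤+ (subst₂ ℤ._≤_ (sym (ℤ.pos-* x (suc q))) (sym (ℤ.pos-* p 1)) h)))
    where
    x≤p/q : x ℕ.* suc q ℕ.≤ p → x ℕ.≤ p / suc q
    x≤p/q xq≤p with x ℕ.≤? p / suc q
    ... | yes x≤ = x≤
    ... | no x≰ = ⊥-elim (ℕ.<-irrefl refl (ℕ.<-≤-trans p<[1+p/q]q (ℕ.≤-trans (ℕ.*-monoˡ-≤ (suc q) (ℕ.≰⇒> x≰)) xq≤p)))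
      where
      p<[1+p/q]q : p ℕ.< suc (p / suc q) ℕ.* suc q
      p<[1+p/q]q = subst (ℕ._< suc (p / suc q) ℕ.* suc q) (sym (m≡m%n+[m/n]*n p (suc q)))
                     (ℕ.+-monoˡ-< ((p / suc q) ℕ.* suc q) (m%n<n p (suc q)))
  ≤⌊⌋ℕ {x} (mkℚ -[1+ p ] q c) le = ⊥-elim (fromℕ≰negative {x} le)

  avgDeg-nonNeg : ∀ {m} (H : Defs.Graph (suc m)) → 0ℚ ≤ Defs.avgDeg H
  avgDeg-nonNeg {m} H = toℚᵘ-cancel-≤ (ℚᵘ.≤-respʳ-≃ (ℚᵘ.≃-sym (toℚᵘ-fromℚᵘ (ℚᵘ.mkℚᵘ (+ e) m)))
    (ℚᵘ.*≤* (subst (+ 0 ℤ.≤_) (sym (ℤ.*-identityʳ (+ e))) (ℤ.+≤+ z≤n))))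
    where e = 2 ℕ.* Defs.numEdges H

  private
    fraction*denominator : ∀ a m → (+ a ℚ./ suc m) * fromℕ (suc m) ≡ fromℕ a
    fraction*denominator a m = toℚᵘ-injective (ℚᵘ.≃-trans (toℚᵘ-homo-* (+ a ℚ./ suc m) (fromℕ (suc m)))
      (ℚᵘ.≃-trans (ℚᵘ.*-cong (toℚᵘ-fromℚᵘ (ℚᵘ.mkℚᵘ (+ a) m)) (toℚᵘ-fromℕ (suc m)))
      (ℚᵘ.≃-trans (ℚᵘ.*≡* (trans (ℤ.*-identityʳ _) (cong (λ z → + a ℤ.* + z) (sym (ℕ.*-identityʳ (suc m))))))
                  (ℚᵘ.≃-sym (toℚᵘ-fromℕ a)))))

    fromℕ-suc-pos : ∀ m → Positive (fromℕ (suc m))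
    fromℕ-suc-pos m = positive (<-≤-trans (*<* (ℤ.+<+ (s≤s z≤n))) (fromℕ-mono-≤ {1} {suc m} (s≤s z≤n)))

  ≤avgDeg⇒ : ∀ a m d → (+ a ℚ./ suc m) ≤ d → fromℕ a ≤ d * fromℕ (suc m)
  ≤avgDeg⇒ a m d le = subst (_≤ d * fromℕ (suc m)) (fraction*denominator a m)
    (*-monoʳ-≤-nonNeg (fromℕ (suc m)) {{nonNegative (fromℕ-nonNeg (suc m))}} le)

  *suc-cancel-≤ : ∀ a m T → fromℕ a * fromℕ (suc m) ≤ T * fromℕ (suc m) → fromℕ a ≤ T
  *suc-cancel-≤ a m T = *-cancelʳ-≤-pos (fromℕ (suc m)) {{fromℕ-suc-pos m}}

  fromℕ-sum≤ : ∀ {D} (f : Fin D → ℕ) X → (∀ i → fromℕ (f i) ≤ X) → fromℕ (sum f) ≤ fromℕ D * X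
  fromℕ-sum≤ {zero} f X h = ≤-reflexive (sym (*-zeroˡ X))
  fromℕ-sum≤ {suc D} f X h = begin
      fromℕ (f Fin.zero ℕ.+ sum (λ i → f (Fin.suc i)))
    ≡⟨ fromℕ-+ (f Fin.zero) _ ⟩
      fromℕ (f Fin.zero) + fromℕ (sum (λ i → f (Fin.suc i)))
    ≤⟨ +-mono-≤ (h Fin.zero) (fromℕ-sum≤ (λ i → f (Fin.suc i)) X (λ i → h (Fin.suc i))) ⟩
      X + fromℕ D * X
    ≡⟨ cong (_+ fromℕ D * X) (sym (*-identityˡ X)) ⟩
      1ℚ * X + fromℕ D * X
    ≡⟨ sym (*-distribʳ-+ X 1ℚ (fromℕ D)) ⟩
      (1ℚ + fromℕ D) * X
    ≡⟨ cong (_* X) (sym (fromℕ-+ 1 D)) ⟩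
      fromℕ (suc D) * X ∎
    where open ≤-Reasoning

module BackEdges {n} (G : Defs.Graph n) (π : Defs.LinOrder n) where

  open import Data.Nat hiding (∣_-_∣)
  open import Data.Nat.Properties
  open import Data.Fin using (Fin; toℕ; fromℕ<)
  import Data.Fin.Properties as Fin
  open import Data.Bool using (Bool; true; false; _∧_; _∨_; not; if_then_else_)
  import Data.Bool.Properties as Bool
  open import Data.Product using (_,_; proj₁; proj₂)
  open import Data.Sum using (inj₁; inj₂)
  open import Data.Empty using (⊥-elim)
  open import Relation.Binary.Definitions using (tri<; tri≈; tri>)
  open import Relation.Binary.PropositionalEquality
  open import Function using (_∘_)
  open import Function.Bundles using (Equivalence)
  open import Defs hiding (sym)
  open Counting
  open Subgraphs
  open Degeneracy using (precedes)

  place : Fin n → ℕ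
  place v = toℕ (proj₁ π v)

  place-injective : ∀ {u v} → place u ≡ place v → u ≡ v
  place-injective eq = proj₂ π (Fin.toℕ-injective eq)

  _◁_ : Fin n → Fin n → Bool
  u ◁ w = adj G u w ∧ precedes π u w

  ◁⇒adj : ∀ {u w} → (u ◁ w) ≡ true → G ⊢ u ~ w
  ◁⇒adj {u} {w} = ∧-elimˡ (adj G u w)

  adj⇒◁ : ∀ {u w} → G ⊢ u ~ w → place u < place w → (u ◁ w) ≡ true
  adj⇒◁ u~w u<w rewrite u~w = <⇒<ᵇ≡true u<w

  linked twoStep commonLater conflict : Fin n → Fin n → Bool
  linked u v = (u ◁ v) ∨ (v ◁ u)
  twoStep u v = ∃ᵇ (λ w → (u ◁ w) ∧ (w ◁ v))
  commonLater u v = ∃ᵇ (λ w → (u ◁ w) ∧ (v ◁ w))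
  conflict u v = not (u == v) ∧ (linked u v ∨ ((twoStep u v ∨ twoStep v u) ∨ commonLater u v))

  conflict-sym : ∀ u v → conflict u v ≡ conflict v u
  conflict-sym u v rewrite ==-sym u v | Bool.∨-comm (u ◁ v) (v ◁ u) | Bool.∨-comm (twoStep u v) (twoStep v u)
    | ∃ᵇ-cong (λ w → (u ◁ w) ∧ (v ◁ w)) (λ w → (v ◁ w) ∧ (u ◁ w)) (λ w → Bool.∧-comm (u ◁ w) (v ◁ w)) = refl

  private
    placed-before : ∀ {u v} → place u ≤ place v → u ≢ v → place u < place v
    placed-before u≤v u≢v = ≤∧≢⇒< u≤v (u≢v ∘ place-injective)

    adj⇒≢ : ∀ {u w} → G ⊢ u ~ w → u ≢ w
    adj⇒≢ {u} u~w refl = true≢false (trans (sym u~w) (irrefl G u))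

  WReach2⇒conflict : ∀ u v → u ≢ v → WReach2 G π u v → conflict u v ≡ true
  WReach2⇒conflict u v u≢v (inj₁ u≡v) = ⊥-elim (u≢v u≡v)
  WReach2⇒conflict u v u≢v (inj₂ (inj₁ (u~v , u≤v))) =
    ∧-intro (not-intro (≢⇒==-false u≢v)) (∨-introˡ _ (∨-introˡ (v ◁ u) (adj⇒◁ u~v (placed-before u≤v u≢v))))
  WReach2⇒conflict u v u≢v (inj₂ (inj₂ (w , u~w , w~v , u≤w , _))) with <-cmp (place w) (place v)
  ... | tri< w<v _ _ = ∧-intro (not-intro (≢⇒==-false u≢v)) (∨-introʳ (linked u v) (∨-introˡ (commonLater u v)
        (∨-introˡ (twoStep v u) (∃ᵇ-intro (λ w → (u ◁ w) ∧ (w ◁ v)) w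
          (∧-intro (adj⇒◁ u~w (placed-before u≤w (adj⇒≢ u~w))) (adj⇒◁ w~v w<v))))))
  ... | tri≈ _ w≡v _ = ⊥-elim (adj⇒≢ w~v (place-injective w≡v))
  ... | tri> _ _ v<w = ∧-intro (not-intro (≢⇒==-false u≢v)) (∨-introʳ (linked u v) (∨-introʳ (twoStep u v ∨ twoStep v u)
        (∃ᵇ-intro (λ w → (u ◁ w) ∧ (v ◁ w)) w
          (∧-intro (adj⇒◁ u~w (placed-before u≤w (adj⇒≢ u~w))) (adj⇒◁ (trans (Graph.sym G v w) w~v) v<w)))))

  backDeg : Fin n → ℕ
  backDeg w = sum (λ u → ⟦ u ◁ w ⟧)

  backRank : Fin n → Fin n → ℕ
  backRank u w = sum (λ x → ⟦ (x <ᶠ u) ∧ (x ◁ w) ⟧)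

  private
    suc-backRank≤ : ∀ u w (L : Subset n) → (∀ x → (x <ᶠ u) ≡ true → L x ≡ true) → L u ≡ true → (u ◁ w) ≡ true →
                    suc (backRank u w) ≤ sum (λ x → ⟦ L x ∧ (x ◁ w) ⟧)
    suc-backRank≤ u w L below⊆L Lu u◁w = begin
        suc (backRank u w)
      ≡⟨ +-comm 1 (backRank u w) ⟩
        backRank u w + 1
      ≡⟨ cong (backRank u w +_) (sym (trans (sum-at u (λ x → ⟦ x ◁ w ⟧)) (cong ⟦_⟧ u◁w))) ⟩
        backRank u w + sum (λ x → if x == u then ⟦ x ◁ w ⟧ else 0)
      ≡⟨ sym (∑-distrib-+ (λ x → ⟦ (x <ᶠ u) ∧ (x ◁ w) ⟧) (λ x → if x == u then ⟦ x ◁ w ⟧ else 0)) ⟩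
        sum (λ x → ⟦ (x <ᶠ u) ∧ (x ◁ w) ⟧ + (if x == u then ⟦ x ◁ w ⟧ else 0))
      ≤⟨ sum-mono-≤ pointwise ⟩
        sum (λ x → ⟦ L x ∧ (x ◁ w) ⟧) ∎
      where
      open ≤-Reasoning
      pointwise : ∀ x → ⟦ (x <ᶠ u) ∧ (x ◁ w) ⟧ + (if x == u then ⟦ x ◁ w ⟧ else 0) ≤ ⟦ L x ∧ (x ◁ w) ⟧
      pointwise x with x == u in x=u
      ... | true rewrite ==⇒≡ x=u | ≤⇒≮ᵇ (≤-refl {toℕ u}) | Lu = ≤-refl
      ... | false with (x <ᶠ u) in x<u
      ... | true rewrite below⊆L x x<u = ≤-reflexive (+-identityʳ _)
      ... | false = z≤n

  backRank<backDeg : ∀ {u w} → (u ◁ w) ≡ true → backRank u w < backDeg w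
  backRank<backDeg {u} {w} = suc-backRank≤ u w (λ _ → true) (λ _ _ → refl) refl

  backRank-injective : ∀ {u u′ w} → (u ◁ w) ≡ true → (u′ ◁ w) ≡ true → backRank u w ≡ backRank u′ w → u ≡ u′
  backRank-injective {u} {u′} {w} u◁w u′◁w eq with <-cmp (toℕ u) (toℕ u′)
  ... | tri< u<u′ _ _ = ⊥-elim (<-irrefl eq (suc-backRank≤ u w (_<ᶠ u′)
          (λ x x<u → <⇒<ᵇ≡true (<-trans (<ᵇ≡true⇒< x<u) u<u′)) (<⇒<ᵇ≡true u<u′) u◁w))
  ... | tri≈ _ u≡u′ _ = Fin.toℕ-injective u≡u′
  ... | tri> _ _ u′<u = ⊥-elim (<-irrefl (sym eq) (suc-backRank≤ u′ w (_<ᶠ u)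
          (λ x x<u′ → <⇒<ᵇ≡true (<-trans (<ᵇ≡true⇒< x<u′) u′<u)) (<⇒<ᵇ≡true u′<u) u′◁w))

  module BoundedBackDegree (D : ℕ) (backDeg≤D : ∀ w → backDeg w ≤ D) where

    sum-twoStep≤ : ∀ v → sum (λ u → sum (λ w → ⟦ (u ◁ w) ∧ (w ◁ v) ⟧)) ≤ D * D
    sum-twoStep≤ v = begin
        sum (λ u → sum (λ w → ⟦ (u ◁ w) ∧ (w ◁ v) ⟧))
      ≡⟨ ∑-comm (λ u w → ⟦ (u ◁ w) ∧ (w ◁ v) ⟧) ⟩
        sum (λ w → sum (λ u → ⟦ (u ◁ w) ∧ (w ◁ v) ⟧))
      ≡⟨ sum-cong-≗ (λ w → trans (sum-cong-≗ (λ u → ⟦∧⟧-flip (u ◁ w) (w ◁ v))) (sum-*ˡ ⟦ w ◁ v ⟧ (λ u → ⟦ u ◁ w ⟧))) ⟩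
        sum (λ w → ⟦ w ◁ v ⟧ * backDeg w)
      ≤⟨ sum-mono-≤ (λ w → *-monoʳ-≤ ⟦ w ◁ v ⟧ (backDeg≤D w)) ⟩
        sum (λ w → ⟦ w ◁ v ⟧ * D)
      ≡⟨ sum-cong-≗ (λ w → *-comm ⟦ w ◁ v ⟧ D) ⟩
        sum (λ w → D * ⟦ w ◁ v ⟧)
      ≡⟨ sum-*ˡ D (λ w → ⟦ w ◁ v ⟧) ⟩
        D * backDeg v
      ≤⟨ *-monoʳ-≤ D (backDeg≤D v) ⟩
        D * D ∎
      where open ≤-Reasoning

    pairSum-twoStep≤ : ∀ S → pairSum S (λ v u → ⟦ twoStep v u ⟧) ≤ ∣ S ∣ * (D * D)
    pairSum-twoStep≤ S = begin
        pairSum S (λ v u → ⟦ twoStep v u ⟧)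
      ≡⟨ sym (pairSum-flip (λ v u → ⟦ twoStep v u ⟧) S) ⟩
        pairSum S (λ v u → ⟦ twoStep u v ⟧)
      ≤⟨ pairSum≤outer (λ v u → ⟦ twoStep u v ⟧) S ⟩
        sum (λ v → ⟦ S v ⟧ * sum (λ u → ⟦ twoStep u v ⟧))
      ≤⟨ sum-mono-≤ (λ v → *-monoʳ-≤ ⟦ S v ⟧
           (≤-trans (sum-mono-≤ (λ u → ⟦∃ᵇ⟧≤sum (λ w → (u ◁ w) ∧ (w ◁ v)))) (sum-twoStep≤ v))) ⟩
        sum (λ v → ⟦ S v ⟧ * (D * D))
      ≡⟨ sum-⟦⟧*≡∣∣* S (D * D) ⟩
        ∣ S ∣ * (D * D) ∎
      where open ≤-Reasoning

    commonLaterIn : Subset n → Fin n → Fin n → Bool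
    commonLaterIn S v u = ∃ᵇ (λ w → S w ∧ ((v ◁ w) ∧ (u ◁ w)))

    -- Count the pairs through their common later neighbour w ∈ S: at most D² per w.
    pairSum-commonLaterIn≤ : ∀ S → pairSum S (λ v u → ⟦ commonLaterIn S v u ⟧) ≤ ∣ S ∣ * (D * D)
    pairSum-commonLaterIn≤ S = begin
        pairSum S (λ v u → ⟦ commonLaterIn S v u ⟧)
      ≤⟨ pairSum≤sum (λ v u → ⟦ commonLaterIn S v u ⟧) S ⟩
        sum (λ v → sum (λ u → ⟦ commonLaterIn S v u ⟧))
      ≤⟨ sum-mono-≤ (λ v → sum-mono-≤ (λ u → ⟦∃ᵇ⟧≤sum (λ w → S w ∧ ((v ◁ w) ∧ (u ◁ w))))) ⟩
        sum (λ v → sum (λ u → sum (λ w → ⟦ S w ∧ ((v ◁ w) ∧ (u ◁ w)) ⟧)))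
      ≡⟨ trans (sum-cong-≗ (λ v → ∑-comm (λ u w → ⟦ S w ∧ ((v ◁ w) ∧ (u ◁ w)) ⟧)))
               (∑-comm (λ v w → sum (λ u → ⟦ S w ∧ ((v ◁ w) ∧ (u ◁ w)) ⟧))) ⟩
        sum (λ w → sum (λ v → sum (λ u → ⟦ S w ∧ ((v ◁ w) ∧ (u ◁ w)) ⟧)))
      ≡⟨ sum-cong-≗ (λ w → sum-cong-≗ (λ v → per-v w v)) ⟩
        sum (λ w → sum (λ v → ⟦ S w ⟧ * (⟦ v ◁ w ⟧ * backDeg w)))
      ≡⟨ sum-cong-≗ (λ w → trans (sum-*ˡ ⟦ S w ⟧ (λ v → ⟦ v ◁ w ⟧ * backDeg w))
           (cong (⟦ S w ⟧ *_) (trans (sum-cong-≗ (λ v → *-comm ⟦ v ◁ w ⟧ (backDeg w))) (sum-*ˡ (backDeg w) (λ v → ⟦ v ◁ w ⟧))))) ⟩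
        sum (λ w → ⟦ S w ⟧ * (backDeg w * backDeg w))
      ≤⟨ sum-mono-≤ (λ w → *-monoʳ-≤ ⟦ S w ⟧ (*-mono-≤ (backDeg≤D w) (backDeg≤D w))) ⟩
        sum (λ w → ⟦ S w ⟧ * (D * D))
      ≡⟨ sum-⟦⟧*≡∣∣* S (D * D) ⟩
        ∣ S ∣ * (D * D) ∎
      where
      open ≤-Reasoning
      per-v : ∀ w v → sum (λ u → ⟦ S w ∧ ((v ◁ w) ∧ (u ◁ w)) ⟧) ≡ ⟦ S w ⟧ * (⟦ v ◁ w ⟧ * backDeg w)
      per-v w v = trans (sum-cong-≗ (λ u → trans (⟦∧⟧ (S w) _) (cong (⟦ S w ⟧ *_) (⟦∧⟧ (v ◁ w) (u ◁ w)))))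
        (trans (sum-*ˡ ⟦ S w ⟧ (λ u → ⟦ v ◁ w ⟧ * ⟦ u ◁ w ⟧)) (cong (⟦ S w ⟧ *_) (sum-*ˡ ⟦ v ◁ w ⟧ (λ u → ⟦ u ◁ w ⟧))))

    rankFin : ∀ {u w} → (u ◁ w) ≡ true → Fin D
    rankFin u◁w = fromℕ< (<-≤-trans (backRank<backDeg u◁w) (backDeg≤D _))

    -- u ∈ S is the i-th earlier neighbour of w, counting from 0 in the order of Fin n.
    owns : Subset n → Fin D → Fin n → Fin n → Bool
    owns S i u w = S u ∧ ((u ◁ w) ∧ (backRank u w ≡ᵇ toℕ i))

    module _ (S : Subset n) (i : Fin D) where

      owns⇒∈ : ∀ {u w} → owns S i u w ≡ true → S u ≡ true
      owns⇒∈ {u} = ∧-elimˡ (S u)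

      owns⇒◁ : ∀ {u w} → owns S i u w ≡ true → (u ◁ w) ≡ true
      owns⇒◁ {u} {w} h = ∧-elimˡ (u ◁ w) (∧-elimʳ (S u) h)

      owns-unique : ∀ {u u′ w} → owns S i u w ≡ true → owns S i u′ w ≡ true → u ≡ u′
      owns-unique {u} {u′} {w} h h′ = backRank-injective (owns⇒◁ h) (owns⇒◁ h′) (trans (rank h) (sym (rank h′)))
        where
        rank : ∀ {x} → owns S i x w ≡ true → backRank x w ≡ toℕ i
        rank {x} h = ≡ᵇ⇒≡ _ _ (Equivalence.from Bool.T-≡ (∧-elimʳ (x ◁ w) (∧-elimʳ (S x) h)))

    owns-rankFin : ∀ {S u w} → S u ≡ true → (u◁w : (u ◁ w) ≡ true) → owns S (rankFin u◁w) u w ≡ true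
    owns-rankFin {S} {u} {w} Su u◁w = ∧-intro Su (∧-intro u◁w (Equivalence.to Bool.T-≡
      (≡⇒≡ᵇ (backRank u w) _ (sym (Fin.toℕ-fromℕ< (<-≤-trans (backRank<backDeg u◁w) (backDeg≤D w)))))))

module Layers {n} (G : Defs.Graph n) (π : Defs.LinOrder n) (D : ℕ)
              (backDeg≤D : ∀ w → BackEdges.backDeg G π w ℕ.≤ D)
              {S : Subgraphs.Subset n} {m} (E : Subgraphs.Enumeration S (suc m)) where

  open import Data.Nat hiding (∣_-_∣)
  open import Data.Nat.Properties
  open import Data.Fin using (Fin; toℕ)
  open import Data.Bool using (Bool; true; false; _∧_; _∨_; not; if_then_else_)
  import Data.Bool.Properties as Bool
  open import Data.Product using (Σ-syntax; ∃; ∃₂; _×_; _,_; proj₂; swap)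
  open import Data.Sum using (_⊎_; inj₁; inj₂)
  open import Data.Maybe as Maybe using (Maybe; just; nothing)
  import Data.Maybe.Properties as Maybe
  open import Data.Empty using (⊥-elim)
  open import Relation.Binary.PropositionalEquality
  open import Data.Nat.Tactic.RingSolver using (solve-∀)
  open import Defs hiding (sym)
  open Counting
  open Subgraphs
  open BackEdges G π
  open BoundedBackDegree D backDeg≤D
  open Enumeration E
  open Index E

  -- Contracting each u ∈ S with the w ∉ S of which it is the i-th earlier neighbour is a depth-1 minor;
  -- rankMinor i is its edge relation on S.
  rankMinor : Fin D → Rel n
  rankMinor i u v = not (u == v) ∧ (adj G u v ∨ (∃ᵇ (λ w → not (S w) ∧ (owns S i u w ∧ (v ◁ w))) ∨
                                                 ∃ᵇ (λ w → not (S w) ∧ (owns S i v w ∧ (u ◁ w)))))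

  rankMinor-sym : ∀ i u v → rankMinor i u v ≡ rankMinor i v u
  rankMinor-sym i u v rewrite ==-sym u v | Graph.sym G u v
    | Bool.∨-comm (∃ᵇ (λ w → not (S w) ∧ (owns S i u w ∧ (v ◁ w)))) (∃ᵇ (λ w → not (S w) ∧ (owns S i v w ∧ (u ◁ w)))) = refl

  rankMinor-irrefl : ∀ i u → rankMinor i u u ≡ false
  rankMinor-irrefl i u rewrite ==-refl u = refl

  module RankMinor (i : Fin D) = Induced E (rankMinor i) (rankMinor-sym i) (rankMinor-irrefl i)

  branch : Fin D → Fin n → Maybe (Fin (suc m))
  branch i v = if S v then just (indexOf v) else Maybe.map indexOf (find (λ u → owns S i u v))

  branch-∈ : ∀ i {v} → S v ≡ true → branch i v ≡ just (indexOf v)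
  branch-∈ i Sv rewrite Sv = refl

  branch-owned : ∀ i {u w} → S w ≡ false → owns S i u w ≡ true → branch i w ≡ just (indexOf u)
  branch-owned i {u} {w} Sw u-owns rewrite Sw with find (λ u → owns S i u w) in found
  ... | just u′ = cong (λ z → just (indexOf z)) (owns-unique S i (find-just (λ u → owns S i u w) found) u-owns)
  ... | nothing = ⊥-elim (true≢false (trans (sym u-owns) (find-nothing _ found u)))

  branch-cases : ∀ i v x → branch i v ≡ just x →
                 (S v ≡ true × indexOf v ≡ x) ⊎ (∃ λ u → owns S i u v ≡ true × indexOf u ≡ x)
  branch-cases i v x h with S v
  ... | true = inj₁ (refl , Maybe.just-injective h)
  ... | false with find (λ u → owns S i u v) in found
  ... | just u = inj₂ (u , find-just _ found , Maybe.just-injective h)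

  branch-elem : ∀ i a → branch i (elem a) ≡ just a
  branch-elem i a = trans (branch-∈ i (elem-∈ a)) (cong just (indexOf-elem a))

  rankMinor-depth1 : ∀ i → DepthMinor G 1 (RankMinor.graph i)
  rankMinor-depth1 i = record
    { β = branch i ; centre = elem ; centre-in = branch-elem i ; radius = radius ; edges = edges }
    where
    radius : ∀ x v → branch i v ≡ just x → WalkIn G (λ w → branch i w ≡ just x) 1 (elem x) v
    radius x v h with branch-cases i v x h
    ... | inj₁ (Sv , refl) rewrite elem-indexOf Sv = nil h
    ... | inj₂ (u , u-owns , refl) rewrite elem-indexOf (owns⇒∈ S i u-owns) =
      cons (branch-∈ i (owns⇒∈ S i u-owns)) (◁⇒adj (owns⇒◁ S i u-owns)) (nil h)
    owned : ∀ x u w → (not (S w) ∧ (owns S i (elem x) w ∧ (u ◁ w))) ≡ true → branch i w ≡ just x × G ⊢ u ~ w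
    owned x u w h = trans (branch-owned i (not-elim (∧-elimˡ (not (S w)) h)) (∧-elimˡ (owns S i (elem x) w) h′))
                          (cong just (indexOf-elem x))
                  , ◁⇒adj (∧-elimʳ (owns S i (elem x) w) h′)
      where h′ = ∧-elimʳ (not (S w)) h
    edges : ∀ x y → RankMinor.graph i ⊢ x ~ y →
            Σ[ u ∈ Fin n ] Σ[ v ∈ Fin n ] (branch i u ≡ just x × branch i v ≡ just y × G ⊢ u ~ v)
    edges x y h with ∨-elim (adj G (elem x) (elem y)) (∧-elimʳ (not (elem x == elem y)) h)
    ... | inj₁ x~y = elem x , elem y , branch-elem i x , branch-elem i y , x~y
    ... | inj₂ via with ∨-elim (∃ᵇ (λ w → not (S w) ∧ (owns S i (elem x) w ∧ (elem y ◁ w)))) via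
    ... | inj₁ viaˣ with ∃ᵇ-elim _ viaˣ
    ...   | (w , hw) with owned x (elem y) w hw
    ...     | (bw , y~w) = w , elem y , bw , branch-elem i y , trans (Graph.sym G w (elem y)) y~w
    edges x y h | inj₂ via | inj₂ viaʸ with ∃ᵇ-elim _ viaʸ
    ...   | (w , hw) with owned y (elem x) w hw
    ...     | (bw , x~w) = elem x , w , branch-elem i x , bw , x~w

  sharesLater : Fin D → Fin D → Fin n → Fin n → Fin n → Bool
  sharesLater i j u v w = (owns S i u w ∧ owns S j v w) ∨ (owns S i v w ∧ owns S j u w)

  -- Each w ∉ S whose i-th and j-th earlier neighbours lie in S subdivides an edge between them,
  -- and no other edge: this is a ≤1-subdivision of rankSubdivision i j.
  rankSubdivision : Fin D → Fin D → Rel n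
  rankSubdivision i j u v = not (u == v) ∧ (adj G u v ∨ ∃ᵇ (λ w → not (S w) ∧ sharesLater i j u v w))

  rankSubdivision-sym : ∀ i j u v → rankSubdivision i j u v ≡ rankSubdivision i j v u
  rankSubdivision-sym i j u v rewrite ==-sym u v | Graph.sym G u v
    | ∃ᵇ-cong (λ w → not (S w) ∧ sharesLater i j u v w) (λ w → not (S w) ∧ sharesLater i j v u w)
        (λ w → cong (not (S w) ∧_) (Bool.∨-comm (owns S i u w ∧ owns S j v w) (owns S i v w ∧ owns S j u w))) = refl

  rankSubdivision-irrefl : ∀ i j u → rankSubdivision i j u u ≡ false
  rankSubdivision-irrefl i j u rewrite ==-refl u = refl

  module RankSubdivision (i j : Fin D) = Induced E (rankSubdivision i j) (rankSubdivision-sym i j) (rankSubdivision-irrefl i j)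

  subdivider : Fin D → Fin D → Fin (suc m) → Fin (suc m) → Maybe (Fin n)
  subdivider i j x y = if adj G (elem x) (elem y) then nothing else find (λ w → not (S w) ∧ sharesLater i j (elem x) (elem y) w)

  subdivider-just : ∀ i j x y s → subdivider i j x y ≡ just s → S s ≡ false × sharesLater i j (elem x) (elem y) s ≡ true
  subdivider-just i j x y s h with adj G (elem x) (elem y)
  ... | false = not-elim (∧-elimˡ (not (S s)) found) , ∧-elimʳ (not (S s)) found
    where found = find-just (λ w → not (S w) ∧ sharesLater i j (elem x) (elem y) w) h

  owners-unique : ∀ {i j s} {a b a′ b′ : Fin (suc m)} →
                  (owns S i (elem a) s ∧ owns S j (elem b) s) ≡ true → (owns S i (elem a′) s ∧ owns S j (elem b′) s) ≡ true →
                  a ≡ a′ × b ≡ b′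
  owners-unique {i} {j} {s} {a} {_} {a′} o o′ =
    elem-injective (owns-unique S i (∧-elimˡ _ o) (∧-elimˡ _ o′)) ,
    elem-injective (owns-unique S j (∧-elimʳ (owns S i (elem a) s) o) (∧-elimʳ (owns S i (elem a′) s) o′))

  -- A subdivision vertex s ∉ S determines both ends of its edge: they are its owners of ranks i and j.
  sharesLater-unique : ∀ i j {x y x′ y′ s} → toℕ x < toℕ y → toℕ x′ < toℕ y′ →
                       sharesLater i j (elem x) (elem y) s ≡ true → sharesLater i j (elem x′) (elem y′) s ≡ true →
                       x ≡ x′ × y ≡ y′
  sharesLater-unique i j {x} {y} {x′} {y′} {s} x<y x′<y′ h h′
    with ∨-elim (owns S i (elem x) s ∧ owns S j (elem y) s) h | ∨-elim (owns S i (elem x′) s ∧ owns S j (elem y′) s) h′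
  ... | inj₁ o | inj₁ o′ = owners-unique o o′
  ... | inj₂ o | inj₂ o′ = swap (owners-unique o o′)
  ... | inj₁ o | inj₂ o′ with owners-unique o o′
  ...   | (refl , refl) = ⊥-elim (<-asym x<y x′<y′)
  sharesLater-unique i j x<y x′<y′ h h′ | inj₂ o | inj₁ o′ with owners-unique o o′
  ...   | (refl , refl) = ⊥-elim (<-asym x<y x′<y′)

  rankSubdivision-half : ∀ i j → HalfSubdivision G (RankSubdivision.graph i j)
  rankSubdivision-half i j = record
    { φ = elem ; φ-inj = elem-injective ; mid = subdivider i j ; direct = direct ; subdiv = subdiv
    ; subdiv-unique = λ x y x′ y′ s x<y _ hs x′<y′ _ hs′ →
        sharesLater-unique i j x<y x′<y′ (proj₂ (subdivider-just i j x y s hs)) (proj₂ (subdivider-just i j x′ y′ s hs′)) }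
    where
    direct : ∀ x y → toℕ x < toℕ y → RankSubdivision.graph i j ⊢ x ~ y → subdivider i j x y ≡ nothing → G ⊢ elem x ~ elem y
    direct x y _ h none with adj G (elem x) (elem y) in x~y
    ... | true = refl
    ... | false with ∃ᵇ-elim _ (∧-elimʳ (not (elem x == elem y)) h)
    ... | (w , hw) = ⊥-elim (true≢false (trans (sym hw) (find-nothing _ none w)))
    subdiv : ∀ x y s → toℕ x < toℕ y → RankSubdivision.graph i j ⊢ x ~ y → subdivider i j x y ≡ just s →
             (G ⊢ elem x ~ s) × (G ⊢ s ~ elem y) × (∀ z → elem z ≢ s)
    subdiv x y s _ _ hs with subdivider-just i j x y s hs
    ... | (Ss , shared) with ends (∨-elim (owns S i (elem x) s ∧ owns S j (elem y) s) shared)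
      where
      ends : _ ⊎ _ → (G ⊢ elem x ~ s) × (G ⊢ s ~ elem y)
      ends (inj₁ o) = ◁⇒adj (owns⇒◁ S i (∧-elimˡ _ o)) , trans (Graph.sym G s (elem y)) (◁⇒adj (owns⇒◁ S j (∧-elimʳ (owns S i (elem x) s) o)))
      ends (inj₂ o) = ◁⇒adj (owns⇒◁ S j (∧-elimʳ (owns S i (elem y) s) o)) , trans (Graph.sym G s (elem y)) (◁⇒adj (owns⇒◁ S i (∧-elimˡ _ o)))
    ... | (x~s , s~y) = x~s , s~y , λ z ez → true≢false (trans (sym (elem-∈ z)) (trans (cong S ez) Ss))

  near : Rel n
  near v u = not (v == u) ∧ (linked v u ∨ ∃ᵇ (λ w → not (S w) ∧ ((v ◁ w) ∧ (u ◁ w))))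

  private
    1≤⟦⟧ : ∀ {b} → b ≡ true → 1 ≤ ⟦ b ⟧
    1≤⟦⟧ refl = ≤-refl

    linked⇒adj : ∀ v u → linked v u ≡ true → G ⊢ v ~ u × ∃₂ λ a b → (a ◁ b) ≡ true
    linked⇒adj v u h with ∨-elim (v ◁ u) h
    ... | inj₁ v◁u = ◁⇒adj v◁u , v , u , v◁u
    ... | inj₂ u◁v = trans (Graph.sym G v u) (◁⇒adj u◁v) , u , v , u◁v

    -- Adjacent pairs lie in every layer; the rank of a back edge merely witnesses that layers exist.
    near⇒rankMinor : ∀ {v u} → S v ≡ true → near v u ≡ true → ∃ λ i → rankMinor i v u ≡ true
    near⇒rankMinor {v} {u} Sv h with ∨-elim (linked v u) (∧-elimʳ (not (v == u)) h)
    ... | inj₁ l with linked⇒adj v u l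
    ...   | (v~u , _ , _ , a◁b) = rankFin a◁b , ∧-intro (∧-elimˡ (not (v == u)) h) (∨-introˡ _ v~u)
    near⇒rankMinor {v} {u} Sv h | inj₂ r with ∃ᵇ-elim _ r
    ... | (w , hw) = rankFin v◁w , ∧-intro (∧-elimˡ (not (v == u)) h) (∨-introʳ (adj G v u) (∨-introˡ _
          (∃ᵇ-intro (λ w → not (S w) ∧ (owns S (rankFin v◁w) v w ∧ (u ◁ w))) w
             (∧-intro (∧-elimˡ (not (S w)) hw) (∧-intro (owns-rankFin {S} Sv v◁w) u◁w)))))
      where v◁w = ∧-elimˡ (v ◁ w) (∧-elimʳ (not (S w)) hw)
            u◁w = ∧-elimʳ (v ◁ w) (∧-elimʳ (not (S w)) hw)

    near⇒rankSubdivision : ∀ {v u} → S v ≡ true → S u ≡ true → near v u ≡ true → ∃₂ λ i j → rankSubdivision i j v u ≡ true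
    near⇒rankSubdivision {v} {u} Sv Su h with ∨-elim (linked v u) (∧-elimʳ (not (v == u)) h)
    ... | inj₁ l with linked⇒adj v u l
    ...   | (v~u , _ , _ , a◁b) = rankFin a◁b , rankFin a◁b , ∧-intro (∧-elimˡ (not (v == u)) h) (∨-introˡ _ v~u)
    near⇒rankSubdivision {v} {u} Sv Su h | inj₂ r with ∃ᵇ-elim _ r
    ... | (w , hw) = rankFin v◁w , rankFin u◁w , ∧-intro (∧-elimˡ (not (v == u)) h) (∨-introʳ (adj G v u)
          (∃ᵇ-intro (λ w → not (S w) ∧ sharesLater (rankFin v◁w) (rankFin u◁w) v u w) w
             (∧-intro (∧-elimˡ (not (S w)) hw)
               (∨-introˡ (owns S (rankFin v◁w) u w ∧ owns S (rankFin u◁w) v w)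
                 (∧-intro (owns-rankFin {S} Sv v◁w) (owns-rankFin {S} Su u◁w))))))
      where v◁w = ∧-elimˡ (v ◁ w) (∧-elimʳ (not (S w)) hw)
            u◁w = ∧-elimʳ (v ◁ w) (∧-elimʳ (not (S w)) hw)

  pairSum-near≤rankMinors : pairSum S (λ v u → ⟦ near v u ⟧) ≤ sum (λ i → edgeSum (rankMinor i) S)
  pairSum-near≤rankMinors = ≤-trans (pairSum-mono-≤ S pointwise)
    (≤-reflexive (trans (pairSum-sum (λ i v u → ⟦ rankMinor i v u ⟧) S) (sum-cong-≗ (λ i → sym (edgeSum≡pairSum (rankMinor i) S)))))
    where
    pointwise : ∀ v u → S v ≡ true → S u ≡ true → ⟦ near v u ⟧ ≤ sum (λ i → ⟦ rankMinor i v u ⟧)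
    pointwise v u Sv _ with near v u in h
    ... | false = z≤n
    ... | true with near⇒rankMinor Sv h
    ... | (i , layer) = ≤-trans (1≤⟦⟧ layer) (term≤sum (λ i → ⟦ rankMinor i v u ⟧) i)

  pairSum-near≤rankSubdivisions : pairSum S (λ v u → ⟦ near v u ⟧) ≤ sum (λ i → sum (λ j → edgeSum (rankSubdivision i j) S))
  pairSum-near≤rankSubdivisions = ≤-trans (pairSum-mono-≤ S pointwise)
    (≤-reflexive (trans (pairSum-sum (λ i v u → sum (λ j → ⟦ rankSubdivision i j v u ⟧)) S)
      (sum-cong-≗ (λ i → trans (pairSum-sum (λ j v u → ⟦ rankSubdivision i j v u ⟧) S)
                                (sum-cong-≗ (λ j → sym (edgeSum≡pairSum (rankSubdivision i j) S)))))))
    where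
    pointwise : ∀ v u → S v ≡ true → S u ≡ true → ⟦ near v u ⟧ ≤ sum (λ i → sum (λ j → ⟦ rankSubdivision i j v u ⟧))
    pointwise v u Sv Su with near v u in h
    ... | false = z≤n
    ... | true with near⇒rankSubdivision Sv Su h
    ... | (i , j , layer) = ≤-trans (1≤⟦⟧ layer)
          (≤-trans (term≤sum (λ j → ⟦ rankSubdivision i j v u ⟧) j) (term≤sum (λ i → sum (λ j → ⟦ rankSubdivision i j v u ⟧)) i))

  private
    thrice : ∀ s x → (s * x + s * x) + s * x ≡ 3 * x * s
    thrice = solve-∀

    ⟦conflict⟧≤ : ∀ v u → ⟦ conflict v u ⟧ ≤ ⟦ near v u ⟧ + ((⟦ twoStep v u ⟧ + ⟦ twoStep u v ⟧) + ⟦ commonLaterIn S v u ⟧)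
    ⟦conflict⟧≤ v u with conflict v u in h
    ... | false = z≤n
    ... | true with ∨-elim (linked v u) (∧-elimʳ (not (v == u)) h)
    ... | inj₁ l = ≤-trans (1≤⟦⟧ {near v u} (∧-intro (∧-elimˡ (not (v == u)) h) (∨-introˡ _ l))) (m≤m+n _ _)
    ... | inj₂ r with ∨-elim (twoStep v u ∨ twoStep u v) r
    ... | inj₁ t with ∨-elim (twoStep v u) t
    ... | inj₁ vu = ≤-trans (1≤⟦⟧ vu) (≤-trans (m≤m+n _ _) (≤-trans (m≤m+n _ _) (m≤n+m _ ⟦ near v u ⟧)))
    ... | inj₂ uv = ≤-trans (1≤⟦⟧ uv) (≤-trans (m≤n+m _ ⟦ twoStep v u ⟧) (≤-trans (m≤m+n _ _) (m≤n+m _ ⟦ near v u ⟧)))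
    ⟦conflict⟧≤ v u | true | inj₂ r | inj₂ c with ∃ᵇ-elim _ c
    ... | (w , hw) with S w in Sw
    ... | true = ≤-trans (1≤⟦⟧ {commonLaterIn S v u} (∃ᵇ-intro (λ w → S w ∧ ((v ◁ w) ∧ (u ◁ w))) w (∧-intro Sw hw)))
                   (≤-trans (m≤n+m _ (⟦ twoStep v u ⟧ + ⟦ twoStep u v ⟧)) (m≤n+m _ ⟦ near v u ⟧))
    ... | false = ≤-trans (1≤⟦⟧ {near v u} (∧-intro (∧-elimˡ (not (v == u)) h) (∨-introʳ (linked v u)
                    (∃ᵇ-intro (λ w → not (S w) ∧ ((v ◁ w) ∧ (u ◁ w))) w (∧-intro (not-intro Sw) hw))))) (m≤m+n _ _)

  edgeSum-conflict≤ : edgeSum conflict S ≤ pairSum S (λ v u → ⟦ near v u ⟧) + 3 * (D * D) * ∣ S ∣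
  edgeSum-conflict≤ = begin
      edgeSum conflict S
    ≡⟨ edgeSum≡pairSum conflict S ⟩
      pairSum S (λ v u → ⟦ conflict v u ⟧)
    ≤⟨ pairSum-mono-≤ S (λ v u _ _ → ⟦conflict⟧≤ v u) ⟩
      pairSum S (λ v u → nr v u + ((ts v u + ts u v) + cl v u))
    ≡⟨ pairSum-+ nr (λ v u → (ts v u + ts u v) + cl v u) S ⟩
      Σnr + pairSum S (λ v u → (ts v u + ts u v) + cl v u)
    ≡⟨ cong (Σnr +_) (trans (pairSum-+ (λ v u → ts v u + ts u v) cl S) (cong (_+ Σcl)
         (trans (pairSum-+ ts (λ v u → ts u v) S) (cong (Σts +_) (pairSum-flip ts S))))) ⟩
      Σnr + ((Σts + Σts) + Σcl)
    ≤⟨ +-monoʳ-≤ Σnr (+-mono-≤ (+-mono-≤ (pairSum-twoStep≤ S) (pairSum-twoStep≤ S)) (pairSum-commonLaterIn≤ S)) ⟩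
      Σnr + ((∣ S ∣ * (D * D) + ∣ S ∣ * (D * D)) + ∣ S ∣ * (D * D))
    ≡⟨ cong (Σnr +_) (thrice ∣ S ∣ (D * D)) ⟩
      Σnr + 3 * (D * D) * ∣ S ∣ ∎
    where
    open ≤-Reasoning
    nr ts cl : Fin n → Fin n → ℕ
    nr v u = ⟦ near v u ⟧
    ts v u = ⟦ twoStep v u ⟧
    cl v u = ⟦ commonLaterIn S v u ⟧
    Σnr = pairSum S nr
    Σts = pairSum S ts
    Σcl = pairSum S cl

module Sparsity where

  open import Data.Nat as ℕ using (suc)
  open import Data.Integer using (+_)
  open import Data.Rational using (ℚ; 0ℚ; _≤_; _*_)
  open import Data.Rational.Properties using (≤-trans; ≤-reflexive)
  open import Data.Bool using (false)
  open import Data.Product using (_,_)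
  open import Relation.Binary.PropositionalEquality
  open import Defs hiding (sym)
  open Subgraphs
  open Degeneracy using (Degenerate)
  open RationalBounds

  IsMaxAvgDeg-nonNeg : ∀ {P : ∀ {m} → Graph (suc m) → Set} {d} → IsMaxAvgDeg P d → 0ℚ ≤ d
  IsMaxAvgDeg-nonNeg ((_ , H , _ , avgDeg≡d) , _) = subst (0ℚ ≤_) avgDeg≡d (avgDeg-nonNeg H)

  module _ {n} {S : Subset n} {m} (E : Enumeration S (suc m))
           (K : Rel n) (K-sym : ∀ u v → K u v ≡ K v u) (K-irrefl : ∀ u → K u u ≡ false) where
    open Induced E K K-sym K-irrefl

    edgeSum≤maxAvgDeg : ∀ {P : ∀ {m} → Graph (suc m) → Set} {d} → IsMaxAvgDeg P d → P graph →
                        fromℕ (edgeSum K S) ≤ d * fromℕ (suc m)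
    edgeSum≤maxAvgDeg {d = d} (_ , maximal) P-graph =
      subst (λ e → fromℕ e ≤ d * fromℕ (suc m)) 2*numEdges (≤avgDeg⇒ (2 ℕ.* numEdges graph) m d (maximal m graph P-graph))

  sparse⇒degenerate : ∀ {n} (K : Rel n) (T : ℚ) →
                      (∀ (S : Subset n) m → ∣ S ∣ ≡ suc m → fromℕ (edgeSum K S) ≤ T * fromℕ (suc m)) →
                      Degenerate K ⌊ T ⌋ℕ
  sparse⇒degenerate K T sparse S m ∣S∣≡1+m with minDegree K S ∣S∣≡1+m
  ... | (v , Sv , deg*∣S∣≤edgeSum) = v , Sv , ≤⌊⌋ℕ T (*suc-cancel-≤ (degIn K S v) m T (≤-trans
          (≤-reflexive (sym (fromℕ-* (degIn K S v) (suc m))))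
          (≤-trans (fromℕ-mono-≤ (subst (λ s → degIn K S v ℕ.* s ℕ.≤ edgeSum K S) ∣S∣≡1+m deg*∣S∣≤edgeSum))
                   (sparse S m ∣S∣≡1+m))))

module WeakColouring {n} (G : Defs.Graph n) where

  open import Data.Nat as ℕ using (ℕ; suc)
  import Data.Nat.Properties as ℕ
  open import Data.Fin using (Fin)
  open import Data.Bool using (_∧_)
  open import Data.Rational using (ℚ; 0ℚ; 1ℚ; _≤_; _+_; _*_; nonNegative)
  open import Data.Rational.Properties
  open import Data.Product using (Σ-syntax; _,_; proj₁; proj₂)
  open import Relation.Binary.PropositionalEquality
  open import Defs hiding (sym)
  open Counting using (sum; ⟦_⟧; sum-cong-≗)
  open Subgraphs
  open Degeneracy
  open RationalBounds
  open Sparsity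

  adj-degenerate : ∀ {d₀} → IsNabla G 0 d₀ → Degenerate (adj G) ⌊ d₀ ⌋ℕ
  adj-degenerate {d₀} ∇₀ = sparse⇒degenerate (adj G) d₀ sparse
    where
    sparse : ∀ (S : Subset n) m → ∣ S ∣ ≡ suc m → fromℕ (edgeSum (adj G) S) ≤ d₀ * fromℕ (suc m)
    sparse S m ∣S∣≡1+m = edgeSum≤maxAvgDeg E (adj G) (Graph.sym G) (irrefl G) {P = λ H → DepthMinor G 0 H} ∇₀ (induced-depth0 G E)
      where E = enumerateOfSize S ∣S∣≡1+m

  degeneracyOrderOf : ∀ {d₀} → IsNabla G 0 d₀ → Σ[ π ∈ LinOrder n ] (∀ w → BackEdges.backDeg G π w ℕ.≤ ⌊ d₀ ⌋ℕ)
  degeneracyOrderOf {d₀} ∇₀ = proj₁ ordered , λ w → ℕ.≤-trans (ℕ.≤-reflexive (sum-cong-≗ (flip w))) (proj₂ ordered w)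
    where
    ordered = degeneracyOrder (adj G) ⌊ d₀ ⌋ℕ (adj-degenerate ∇₀)
    flip : ∀ w u → ⟦ BackEdges._◁_ G (proj₁ ordered) u w ⟧ ≡ ⟦ adj G w u ∧ precedes (proj₁ ordered) u w ⟧
    flip w u = cong (λ b → ⟦ b ∧ precedes (proj₁ ordered) u w ⟧) (Graph.sym G u w)

  module _ (π : LinOrder n) where
    open BackEdges G π

    wcol≤1+ : ∀ {k} T → IsWcol2* G k → 0ℚ ≤ T →
              (∀ (S : Subset n) m → ∣ S ∣ ≡ suc m → fromℕ (edgeSum conflict S) ≤ T * fromℕ (suc m)) →
              fromℕ k ≤ 1ℚ + T
    wcol≤1+ {k} T (_ , minimal) 0≤T sparse = begin
        fromℕ k                 ≤⟨ fromℕ-mono-≤ (minimal (suc t) (π , colour , proper)) ⟩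
        fromℕ (1 ℕ.+ t)         ≡⟨ fromℕ-+ 1 t ⟩
        1ℚ + fromℕ t            ≤⟨ +-monoʳ-≤ 1ℚ (fromℕ⌊⌋ℕ≤ T 0≤T) ⟩
        1ℚ + T                  ∎
      where
      open ≤-Reasoning
      t = ⌊ T ⌋ℕ
      colouring = greedyColouring conflict conflict-sym t (sparse⇒degenerate conflict T sparse)
      colour = proj₁ colouring
      proper : ∀ u v → u ≢ v → WReach2 G π u v → colour u ≢ colour v
      proper u v u≢v reach = proj₂ colouring u v u≢v (WReach2⇒conflict u v u≢v reach)

    module _ (D : ℕ) (backDeg≤D : ∀ w → backDeg w ℕ.≤ D) where

      private
        3D² = 3 ℕ.* (D ℕ.* D)

      conflict-sparse₁ : ∀ {d₁} → IsNabla G 1 d₁ → ∀ (S : Subset n) m → ∣ S ∣ ≡ suc m →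
                         fromℕ (edgeSum conflict S) ≤ (fromℕ D * d₁ + fromℕ 3D²) * fromℕ (suc m)
      conflict-sparse₁ {d₁} ∇₁ S m ∣S∣≡1+m = ≤+*⇒≤[+]* 3D² m (fromℕ D * d₁) conflict≤ layers≤
        where
        E = enumerateOfSize S ∣S∣≡1+m
        module L = Layers G π D backDeg≤D E
        layers : ℕ
        layers = sum (λ i → edgeSum (L.rankMinor i) S)
        conflict≤ : edgeSum conflict S ℕ.≤ layers ℕ.+ 3D² ℕ.* suc m
        conflict≤ = subst (λ s → edgeSum conflict S ℕ.≤ layers ℕ.+ 3D² ℕ.* s) ∣S∣≡1+m
          (ℕ.≤-trans L.edgeSum-conflict≤ (ℕ.+-monoˡ-≤ (3D² ℕ.* ∣ S ∣) L.pairSum-near≤rankMinors))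
        layers≤ : fromℕ layers ≤ (fromℕ D * d₁) * fromℕ (suc m)
        layers≤ = ≤-trans (fromℕ-sum≤ (λ i → edgeSum (L.rankMinor i) S) (d₁ * fromℕ (suc m))
                   (λ i → edgeSum≤maxAvgDeg E (L.rankMinor i) (L.rankMinor-sym i) (L.rankMinor-irrefl i) ∇₁ (L.rankMinor-depth1 i)))
                 (≤-reflexive (sym (*-assoc (fromℕ D) d₁ (fromℕ (suc m)))))

      conflict-sparse½ : ∀ {d½} → IsNablaTildeHalf G d½ → ∀ (S : Subset n) m → ∣ S ∣ ≡ suc m →
                         fromℕ (edgeSum conflict S) ≤ (fromℕ D * (fromℕ D * d½) + fromℕ 3D²) * fromℕ (suc m)
      conflict-sparse½ {d½} ∇½ S m ∣S∣≡1+m = ≤+*⇒≤[+]* 3D² m (fromℕ D * (fromℕ D * d½)) conflict≤ layers≤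
        where
        E = enumerateOfSize S ∣S∣≡1+m
        module L = Layers G π D backDeg≤D E
        layer : Fin D → Fin D → ℕ
        layer i j = edgeSum (L.rankSubdivision i j) S
        layers : ℕ
        layers = sum (λ i → sum (layer i))
        conflict≤ : edgeSum conflict S ℕ.≤ layers ℕ.+ 3D² ℕ.* suc m
        conflict≤ = subst (λ s → edgeSum conflict S ℕ.≤ layers ℕ.+ 3D² ℕ.* s) ∣S∣≡1+m
          (ℕ.≤-trans L.edgeSum-conflict≤ (ℕ.+-monoˡ-≤ (3D² ℕ.* ∣ S ∣) L.pairSum-near≤rankSubdivisions))
        layer≤ : ∀ i j → fromℕ (layer i j) ≤ d½ * fromℕ (suc m)
        layer≤ i j = edgeSum≤maxAvgDeg E (L.rankSubdivision i j) (L.rankSubdivision-sym i j) (L.rankSubdivision-irrefl i j)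
                       ∇½ (L.rankSubdivision-half i j)
        layers≤ : fromℕ layers ≤ (fromℕ D * (fromℕ D * d½)) * fromℕ (suc m)
        layers≤ = ≤-trans (fromℕ-sum≤ (λ i → sum (layer i)) (fromℕ D * (d½ * fromℕ (suc m)))
                            (λ i → fromℕ-sum≤ (layer i) (d½ * fromℕ (suc m)) (layer≤ i)))
          (≤-reflexive (trans (cong (fromℕ D *_) (sym (*-assoc (fromℕ D) d½ (fromℕ (suc m)))))
                              (sym (*-assoc (fromℕ D) (fromℕ D * d½) (fromℕ (suc m))))))

  module _ {k d₀} (wcol : IsWcol2* G k) (∇₀ : IsNabla G 0 d₀) where

    private
      π = proj₁ (degeneracyOrderOf ∇₀)
      D = ⌊ d₀ ⌋ℕ
      backDeg≤D = proj₂ (degeneracyOrderOf ∇₀)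
      3D² = 3 ℕ.* (D ℕ.* D)
      D≤d₀ : fromℕ D ≤ d₀
      D≤d₀ = fromℕ⌊⌋ℕ≤ d₀ (IsMaxAvgDeg-nonNeg ∇₀)
      0≤D : 0ℚ ≤ fromℕ D
      0≤D = fromℕ-nonNeg D
      0≤3D² : 0ℚ ≤ fromℕ 3D²
      0≤3D² = fromℕ-nonNeg 3D²

    wcol≤3d₀²+1+d₀d₁ : ∀ {d₁} → IsNabla G 1 d₁ → fromℕ k ≤ (fromℕ 3 * d₀ * d₀ + 1ℚ) + d₀ * d₁
    wcol≤3d₀²+1+d₀d₁ {d₁} ∇₁ = ≤-trans
      (wcol≤1+ π (fromℕ D * d₁ + fromℕ 3D²) wcol (+-nonNeg (*-nonNeg 0≤D 0≤d₁) 0≤3D²) (conflict-sparse₁ π D backDeg≤D ∇₁))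
      (1+[a+b]≤[b′+1]+a′ (*-monoʳ-≤-nonNeg d₁ {{nonNegative 0≤d₁}} D≤d₀) (fromℕ[c*D*D]≤c*d*d 3 D D≤d₀))
      where 0≤d₁ = IsMaxAvgDeg-nonNeg ∇₁

    wcol≤3d₀²+1+d₀²d½ : ∀ {d½} → IsNablaTildeHalf G d½ → fromℕ k ≤ (fromℕ 3 * d₀ * d₀ + 1ℚ) + d₀ * d₀ * d½
    wcol≤3d₀²+1+d₀²d½ {d½} ∇½ = ≤-trans
      (wcol≤1+ π (fromℕ D * (fromℕ D * d½) + fromℕ 3D²) wcol (+-nonNeg (*-nonNeg 0≤D (*-nonNeg 0≤D 0≤d½)) 0≤3D²)
        (conflict-sparse½ π D backDeg≤D ∇½))
      (1+[a+b]≤[b′+1]+a′ (fromℕ[D*[D*x]]≤d*d*x D 0≤d½ D≤d₀) (fromℕ[c*D*D]≤c*d*d 3 D D≤d₀))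
      where 0≤d½ = IsMaxAvgDeg-nonNeg ∇½

open import Defs
open import Data.Integer using (+_)
open import Data.Rational using (ℚ; 1ℚ; _/_; _≤_; _+_; _*_; _⊓_)
open RationalBounds using (fromℕ; ≤+⊓)
open WeakColouring

theorem6 : ∀ {n} (G : Graph n) (k : ℕ) (d₀ d₁ d½ : ℚ) →
    IsWcol2* G k → IsNabla G 0 d₀ → IsNabla G 1 d₁ → IsNablaTildeHalf G d½ →
    (+ k / 1) ≤ (+ 3 / 1) * d₀ * d₀ + (+ 1 / 1) + ((d₀ * d₁) ⊓ (d₀ * d₀ * d½))
theorem6 G k d₀ d₁ d½ wcol ∇₀ ∇₁ ∇½ =
  ≤+⊓ {a = fromℕ 3 * d₀ * d₀ + 1ℚ} (wcol≤3d₀²+1+d₀d₁ G wcol ∇₀ ∇₁) (wcol≤3d₀²+1+d₀²d½ G wcol ∇₀ ∇½)
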